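{- Let $\mathcal E$ be a family of $3$-regular $2$-connected expander graphs. Then there is a constant $c>0$ such that for every $G\in\mathcal E$ and every set $W\subseteq V(G)$ there is a set $\hat W\supseteq W$ of size $|\hat W|\le c|W|$ such that $G\setminus\hat W$ (the subgraph induced on $V(G)\setminus\hat W$) is either empty or $2$-connected.
   Context: For a graph $G$ and $W\subseteq V(G)$, $\partial(W)$ is the set of edges with one endpoint in $W$ and the other outside $W$. The expansion ratio of $G$ is $h(G)=\min\{|\partial(W)|/|W| : 0<|W|\le|V(G)|/2\}$; for a family $\mathcal E$, $h(\mathcal E)=\inf_{G\in\mathcal E}h(G)$. A family of expander graphs is an infinite family $\mathcal E$ with $h(\mathcal E)>0$. -}

module Defs where

open import Data.Nat as ℕ using (ℕ; zero; suc; _+_; _*_)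
open import Data.Integer using (+_)
open import Data.Rational as ℚ using (ℚ; _/_; 0ℚ)
open import Data.Bool using (Bool; true; false; not; _∧_)
open import Data.Fin using (Fin)
open import Data.Fin.Subset using (Subset; _∈_; _∉_; ∣_∣; _-_; ⁅_⁆)
open import Data.Vec using (tabulate)
open import Data.Product using (Σ; ∃; _×_; _,_)
open import Relation.Binary.PropositionalEquality using (_≡_)

record Graph : Set where
  field
    n     : ℕ
    adj   : Fin n → Fin n → Bool
    sym   : ∀ u v → adj u v ≡ adj v u
    irrefl : ∀ u → adj u u ≡ false
open Graph public

N[_] : (G : Graph) → Fin (n G) → Subset (n G)
N[ G ] u = tabulate (adj G u)

degree : (G : Graph) → Fin (n G) → ℕ
degree G u = ∣ N[ G ] u ∣

Cubic : Graph → Set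
Cubic G = ∀ u → degree G u ≡ 3

-- ∂(W): edges with exactly one endpoint in W.  Each such edge uv (u ∈ W, v ∉ W)
-- is counted once, as the ordered pair (u , v) with u ∈ W.
-- outNbrs W u = set of neighbours v of u with v ∉ W  (when u ∈ W, else ∅).
outNbrs : (G : Graph) → Subset (n G) → Fin (n G) → Subset (n G)
outNbrs G W u = tabulate (λ v → Data.Vec.lookup W u ∧ (adj G u v ∧ not (Data.Vec.lookup W v)))
  where import Data.Vec

sumFin : ∀ {m} → (Fin m → ℕ) → ℕ
sumFin {zero} f = 0
sumFin {suc m} f = f Fin.zero + sumFin (λ i → f (Fin.suc i))
  where import Data.Fin as Fin

boundarySize : (G : Graph) → Subset (n G) → ℕ
boundarySize G W = sumFin (λ u → ∣ outNbrs G W u ∣)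

data WalkIn (G : Graph) (S : Subset (n G)) : Fin (n G) → Fin (n G) → Set where
  here : ∀ {u} → u ∈ S → WalkIn G S u u
  step : ∀ {u w v} → u ∈ S → adj G u w ≡ true → WalkIn G S w v → WalkIn G S u v

ConnectedOn : (G : Graph) → Subset (n G) → Set
ConnectedOn G S = ∀ u v → u ∈ S → v ∈ S → WalkIn G S u v

-- G[S] is 2-connected (Diestel): |S| > 2 and G[S] - X is connected for every
-- X ⊆ S with |X| < 2, i.e. X = ∅ or X = {x}.
TwoConnectedOn : (G : Graph) → Subset (n G) → Set
TwoConnectedOn G S = (2 ℕ.< ∣ S ∣) × ConnectedOn G S × (∀ x → x ∈ S → ConnectedOn G (S - x))

fullSet : (G : Graph) → Subset (n G)
fullSet G = Data.Fin.Subset.⊤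
  where import Data.Fin.Subset

TwoConnected : Graph → Set
TwoConnected G = TwoConnectedOn G (fullSet G)

-- ε ≤ h(G): for every W with 0 < |W| ≤ |V(G)|/2 one has ε ≤ |∂W| / |W|,
-- i.e. ε · |W| ≤ |∂W|  (as rationals).
ExpansionAtLeast : ℚ → Graph → Set
ExpansionAtLeast ε G =
  ∀ (W : Subset (n G)) → 0 ℕ.< ∣ W ∣ → 2 * ∣ W ∣ ℕ.≤ n G →
    ε ℚ.* (+ ∣ W ∣ / 1) ℚ.≤ (+ boundarySize G W / 1)

Family : Set₁
Family = Graph → Set

-- infinite family: contains graphs with arbitrarily many vertices
-- (equivalent to containing infinitely many graphs, since there are finitely
-- many graphs on Fin m for each m).
Infinite : Family → Set
Infinite ℰ = ∀ (N : ℕ) → Σ Graph (λ G → ℰ G × N ℕ.< n G)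

-- h(ℰ) = inf_G h(G) > 0  ⇔  there is a rational ε > 0 with ε ≤ h(G) for all G ∈ ℰ.
PositiveExpansion : Family → Set
PositiveExpansion ℰ = Σ ℚ (λ ε → (0ℚ ℚ.< ε) × (∀ G → ℰ G → ExpansionAtLeast ε G))

IsExpanderFamily : Family → Set
IsExpanderFamily ℰ = Infinite ℰ × PositiveExpansion ℰ

module Submission where

-- Fix G and an integral expansion constant q: |X| ≤ q·|∂X| whenever 2|X| ≤ |V|
-- (obtained from the rational bound ε of the family).  If W = ∅ take Ŵ = ∅;
-- if |V| ≤ 6q take Ŵ = V.  Otherwise grow U ⊇ W: while G[V ∖ U] is neither
-- empty nor 2-connected, maximum degree 3 yields a part X of V ∖ U meeting
-- the rest of V ∖ U in at most one edge, and absorbing X (or a largest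
-- "blob", a piece hanging on exactly two edges) strictly lowers the potential
--   Φ U = A·|∂U| + |U| + B·#(vertices next to U lying in a blob of U).
-- As Φ W ≤ K·|W| and |U| ≤ Φ U, the final U has at most K·|W| vertices.

open import Defs hiding (sym)
open import Data.Nat using (ℕ; zero; suc; _+_; _*_; _∸_; _≤_; _<_; z≤n; s≤s; _≤?_)
open import Data.Nat.Properties
open import Data.Bool using (Bool; true; false; not; _∧_; _∨_)
import Data.Bool as Bool
open import Data.Bool.Properties using (∧-identityʳ; ∧-zeroʳ; not-involutive; ¬-not)
open import Data.Fin using (Fin)
import Data.Fin as F
import Data.Fin.Properties as F
open import Data.Fin.Subset using (Subset; _⊆_; ∣_∣; ∁; Empty; _∈_; _-_; ⁅_⁆; _─_; ⊤)
open import Data.Vec using ([]; _∷_; lookup; tabulate)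
open import Data.Vec.Properties using (lookup∘tabulate; lookup-map; lookup-replicate; []=⇒lookup; lookup⇒[]=)
open import Data.Product using (Σ; ∃; _×_; _,_; proj₁; proj₂)
open import Data.Sum using (_⊎_; inj₁; inj₂)
open import Data.Empty using (⊥-elim)
open import Relation.Nullary using (¬_; Dec; yes; no; does)
open import Relation.Nullary.Decidable using (_×-dec_; _→-dec_; dec-true; dec-false)
open import Relation.Binary.PropositionalEquality
import Data.Fin.Subset as Sub
open import Data.Fin.Subset.Properties using (anySubset?; nonempty?; Empty-unique; ∣⊤∣≡n; ∈⊤; x∈∁p⇒x∉p; p∪∁p≡⊤; ∪-identityˡ; x∈⁅x⁆; x∈⁅y⁆⇒x≡y)
open import Algebra.Properties.CommutativeSemigroup +-commutativeSemigroup using (interchange)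
open import Data.Nat.Solver using (module +-*-Solver)
import Data.Integer as ℤ
import Data.Integer.Properties as ZP
import Data.Rational as ℚ
import Data.Rational.Properties as ℚP
import Data.Rational.Unnormalised as U
import Data.Rational.Unnormalised.Properties as UP

⟦_⟧ : Bool → ℕ
⟦ true ⟧ = 1
⟦ false ⟧ = 0

⟦⟧-mono : ∀ {x y} → (x ≡ true → y ≡ true) → ⟦ x ⟧ ≤ ⟦ y ⟧
⟦⟧-mono {false} _ = z≤n
⟦⟧-mono {true} h rewrite h refl = ≤-refl

sum-cong : ∀ {m} {f g : Fin m → ℕ} → (∀ i → f i ≡ g i) → sumFin f ≡ sumFin g
sum-cong {zero} h = refl
sum-cong {suc m} h = cong₂ _+_ (h F.zero) (sum-cong (λ i → h (F.suc i)))

sum-mono : ∀ {m} {f g : Fin m → ℕ} → (∀ i → f i ≤ g i) → sumFin f ≤ sumFin g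
sum-mono {zero} h = z≤n
sum-mono {suc m} h = +-mono-≤ (h F.zero) (sum-mono (λ i → h (F.suc i)))

sum-+ : ∀ {m} (f g : Fin m → ℕ) → sumFin (λ i → f i + g i) ≡ sumFin f + sumFin g
sum-+ {zero} f g = refl
sum-+ {suc m} f g = trans (cong (f F.zero + g F.zero +_) (sum-+ (λ i → f (F.suc i)) (λ i → g (F.suc i))))
                          (interchange (f F.zero) (g F.zero) _ _)

sum-zero : ∀ {m} (f : Fin m → ℕ) → (∀ i → f i ≡ 0) → sumFin f ≡ 0
sum-zero {zero} f h = refl
sum-zero {suc m} f h = cong₂ _+_ (h F.zero) (sum-zero _ (λ i → h (F.suc i)))

sum-scale : ∀ {m} c (f : Fin m → ℕ) → sumFin (λ i → c * f i) ≡ c * sumFin f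
sum-scale {zero} c f = sym (*-zeroʳ c)
sum-scale {suc m} c f =
  trans (cong (c * f F.zero +_) (sum-scale c (λ i → f (F.suc i)))) (sym (*-distribˡ-+ c (f F.zero) _))

sum-swap : ∀ {m k} (f : Fin m → Fin k → ℕ) →
  sumFin (λ i → sumFin (λ j → f i j)) ≡ sumFin (λ j → sumFin (λ i → f i j))
sum-swap {zero} {k} f = sym (sum-zero {k} _ (λ j → refl))
sum-swap {suc m} f = trans (cong (sumFin (f F.zero) +_) (sum-swap (λ i → f (F.suc i))))
                           (sym (sum-+ (f F.zero) _))

sum-single : ∀ {m} (f : Fin m → ℕ) i → f i ≤ sumFin f
sum-single f F.zero = m≤m+n _ _
sum-single f (F.suc i) = ≤-trans (sum-single (λ j → f (F.suc j)) i) (m≤n+m _ _)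

sum-pos : ∀ {m} (f : Fin m → ℕ) → 1 ≤ sumFin f → ∃ λ i → 1 ≤ f i
sum-pos {suc m} f h with f F.zero in eq
... | suc _ = F.zero , subst (1 ≤_) (sym eq) (s≤s z≤n)
... | zero with sum-pos (λ i → f (F.suc i)) h
...   | i , p = F.suc i , p

sum-strict : ∀ {m} {f g : Fin m → ℕ} → (∀ i → f i ≤ g i) → ∀ i → f i < g i → sumFin f < sumFin g
sum-strict h F.zero lt = +-mono-≤ lt (sum-mono (λ i → h (F.suc i)))
sum-strict {f = f} h (F.suc i) lt =
  ≤-trans (≤-reflexive (sym (+-suc (f F.zero) _))) (+-mono-≤ (h F.zero) (sum-strict (λ j → h (F.suc j)) i lt))

sum-two : ∀ {m} (f : Fin m → ℕ) i j → ¬ i ≡ j → 1 ≤ f i → 1 ≤ f j → 2 ≤ sumFin f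
sum-two f F.zero F.zero i≢j _ _ = ⊥-elim (i≢j refl)
sum-two f F.zero (F.suc j) _ a b = +-mono-≤ a (≤-trans b (sum-single (λ k → f (F.suc k)) j))
sum-two f (F.suc i) F.zero _ a b = +-mono-≤ b (≤-trans a (sum-single (λ k → f (F.suc k)) i))
sum-two f (F.suc i) (F.suc j) i≢j a b =
  ≤-trans (sum-two (λ k → f (F.suc k)) i j (λ e → i≢j (cong F.suc e)) a b) (m≤n+m _ _)

sum-delta : ∀ {m} (f : Fin m → ℕ) x → (∀ i → ¬ i ≡ x → f i ≡ 0) → sumFin f ≡ f x
sum-delta f F.zero h = trans (cong (f F.zero +_) (sum-zero _ (λ i → h (F.suc i) (λ ())))) (+-identityʳ _)
sum-delta f (F.suc x) h = trans (cong (_+ sumFin (λ i → f (F.suc i))) (h F.zero (λ ())))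
  (sum-delta (λ i → f (F.suc i)) x (λ i i≢x → h (F.suc i) (λ e → i≢x (F.suc-injective e))))

sum-bound : ∀ {m} (f : Fin m → Bool) → sumFin (λ i → ⟦ f i ⟧) ≤ m
sum-bound {zero} f = z≤n
sum-bound {suc m} f = +-mono-≤ (bound (f F.zero)) (sum-bound (λ i → f (F.suc i)))
  where
  bound : ∀ b → ⟦ b ⟧ ≤ 1
  bound true = ≤-refl
  bound false = z≤n

sum-complement : ∀ {m} (f : Fin m → Bool) → sumFin (λ i → ⟦ f i ⟧) + sumFin (λ i → ⟦ not (f i) ⟧) ≡ m
sum-complement {zero} f = refl
sum-complement {suc m} f = begin
    ⟦ f F.zero ⟧ + tail + (⟦ not (f F.zero) ⟧ + tail')
  ≡⟨ interchange ⟦ f F.zero ⟧ tail ⟦ not (f F.zero) ⟧ tail' ⟩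
    (⟦ f F.zero ⟧ + ⟦ not (f F.zero) ⟧) + (tail + tail')
  ≡⟨ cong₂ _+_ (one (f F.zero)) (sum-complement (λ i → f (F.suc i))) ⟩
    suc m ∎
  where
  open ≡-Reasoning
  tail tail' : ℕ
  tail = sumFin (λ i → ⟦ f (F.suc i) ⟧)
  tail' = sumFin (λ i → ⟦ not (f (F.suc i)) ⟧)
  one : ∀ b → ⟦ b ⟧ + ⟦ not b ⟧ ≡ 1
  one true = refl
  one false = refl

false≢true : false ≡ true → ∀ {A : Set} → A
false≢true ()

_≡ᵇ_ : ∀ {m} → Fin m → Fin m → Bool
i ≡ᵇ j = does (i F.≟ j)

≡ᵇ-refl : ∀ {m} (i : Fin m) → i ≡ᵇ i ≡ true
≡ᵇ-refl i = dec-true (i F.≟ i) refl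

≡ᵇ-sound : ∀ {m} (i j : Fin m) → i ≡ᵇ j ≡ true → i ≡ j
≡ᵇ-sound i j h with i F.≟ j
... | yes i≡j = i≡j

≡ᵇ-false : ∀ {m} (i j : Fin m) → ¬ i ≡ j → i ≡ᵇ j ≡ false
≡ᵇ-false i j = dec-false (i F.≟ j)

anyᵇ : ∀ {m} → (Fin m → Bool) → Bool
anyᵇ f = does (F.any? (λ i → f i Bool.≟ true))

anyᵇ-sound : ∀ {m} (f : Fin m → Bool) → anyᵇ f ≡ true → ∃ λ i → f i ≡ true
anyᵇ-sound f h with F.any? (λ i → f i Bool.≟ true)
... | yes witness = witness

anyᵇ-complete : ∀ {m} (f : Fin m → Bool) i → f i ≡ true → anyᵇ f ≡ true
anyᵇ-complete f i h = dec-true (F.any? (λ i → f i Bool.≟ true)) (i , h)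

mem→ : ∀ {m} {p : Subset m} {x} → x ∈ p → lookup p x ≡ true
mem→ = []=⇒lookup

→mem : ∀ {m} {p : Subset m} {x} → lookup p x ≡ true → x ∈ p
→mem {p = p} {x} = lookup⇒[]= x p

card-vec : ∀ {m} (p : Subset m) → ∣ p ∣ ≡ sumFin (λ i → ⟦ lookup p i ⟧)
card-vec [] = refl
card-vec (true ∷ p) = cong suc (card-vec p)
card-vec (false ∷ p) = card-vec p

card-tab : ∀ {m} (f : Fin m → Bool) → ∣ tabulate f ∣ ≡ sumFin (λ i → ⟦ f i ⟧)
card-tab f = trans (card-vec (tabulate f)) (sum-cong (λ i → cong ⟦_⟧ (lookup∘tabulate f i)))

lookup-⊤ : ∀ {m} (i : Fin m) → lookup (⊤ {m}) i ≡ true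
lookup-⊤ i = lookup-replicate i true

lookup-∁ : ∀ {m} (p : Subset m) i → lookup (∁ p) i ≡ not (lookup p i)
lookup-∁ p i = lookup-map i not p

lookup-⁅⁆ : ∀ {m} (x i : Fin m) → lookup ⁅ x ⁆ i ≡ i ≡ᵇ x
lookup-⁅⁆ x i with i F.≟ x | lookup ⁅ x ⁆ i in eq
... | yes _ | true = refl
... | yes refl | false = false≢true (trans (sym eq) (mem→ (x∈⁅x⁆ x)))
... | no i≢x | true = ⊥-elim (i≢x (x∈⁅y⁆⇒x≡y x (→mem eq)))
... | no _ | false = refl

lookup-─ : ∀ {m} (p q : Subset m) i → lookup (p ─ q) i ≡ lookup p i ∧ not (lookup q i)
lookup-─ (a ∷ p) (false ∷ q) F.zero = sym (∧-identityʳ a)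
lookup-─ (a ∷ p) (true ∷ q) F.zero = sym (∧-zeroʳ a)
lookup-─ (a ∷ p) (b ∷ q) (F.suc i) = lookup-─ p q i

lookup-minus : ∀ {m} (p : Subset m) x i → lookup (p - x) i ≡ lookup p i ∧ not (i ≡ᵇ x)
lookup-minus p x i = trans (lookup-─ p ⁅ x ⁆ i) (cong (λ z → lookup p i ∧ not z) (lookup-⁅⁆ x i))

-- A vertex set is a Boolean predicate;
-- e A B counts the ordered pairs (u , v) with u ∈ A, v ∈ B and uv an edge, so
-- ∂ U = e U (V ∖ U) is the size of the edge boundary ∂(U) of the paper.
module Counting (G : Graph) where

  N : ℕ
  N = n G

  VSet : Set
  VSet = Fin N → Bool

  _⊆ᵇ_ : VSet → VSet → Set
  A ⊆ᵇ B = ∀ i → A i ≡ true → B i ≡ true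

  _≐_ : VSet → VSet → Set
  A ≐ B = ∀ i → A i ≡ B i

  compl : VSet → VSet
  compl U i = not (U i)

  _∪ᵇ_ : VSet → VSet → VSet
  (U ∪ᵇ X) i = U i ∨ X i

  card : VSet → ℕ
  card A = sumFin (λ i → ⟦ A i ⟧)

  e : VSet → VSet → ℕ
  e A B = sumFin (λ u → sumFin (λ v → ⟦ A u ∧ (adj G u v ∧ B v) ⟧))

  eFrom : VSet → VSet → Fin N → ℕ
  eFrom A B u = sumFin (λ v → ⟦ A u ∧ (adj G u v ∧ B v) ⟧)

  eInto : VSet → VSet → Fin N → ℕ
  eInto A B v = sumFin (λ u → ⟦ A u ∧ (adj G u v ∧ B v) ⟧)

  nbrsIn : VSet → Fin N → ℕ
  nbrsIn A s = sumFin (λ u → ⟦ A u ∧ adj G u s ⟧)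

  ∂ : VSet → ℕ
  ∂ U = e U (compl U)

  card-cong : ∀ {A B : VSet} → A ≐ B → card A ≡ card B
  card-cong h = sum-cong (λ i → cong ⟦_⟧ (h i))

  card-split : ∀ (A C : VSet) → card A ≡ card (λ i → A i ∧ C i) + card (λ i → A i ∧ not (C i))
  card-split A C = trans (sum-cong (λ i → split (A i) (C i)))
                         (sum-+ (λ i → ⟦ A i ∧ C i ⟧) (λ i → ⟦ A i ∧ not (C i) ⟧))
    where
    split : ∀ x c → ⟦ x ⟧ ≡ ⟦ x ∧ c ⟧ + ⟦ x ∧ not c ⟧
    split false c = refl
    split true false = refl
    split true true = refl

  card-bound : ∀ (A : VSet) → card A ≤ N
  card-bound = sum-bound

  card-compl : ∀ (A : VSet) → card A + card (compl A) ≡ N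
  card-compl = sum-complement

  card-pos : ∀ (A : VSet) i → A i ≡ true → 1 ≤ card A
  card-pos A i h = ≤-trans (≤-reflexive (cong ⟦_⟧ (sym h))) (sum-single (λ j → ⟦ A j ⟧) i)

  card-pos⁻ : ∀ (A : VSet) → 1 ≤ card A → ∃ λ i → A i ≡ true
  card-pos⁻ A h with sum-pos (λ j → ⟦ A j ⟧) h
  ... | i , p with A i in eq
  ...   | true = i , eq

  e-cong : ∀ {A A' B B' : VSet} → A ≐ A' → B ≐ B' → e A B ≡ e A' B'
  e-cong hA hB = sum-cong (λ u → sum-cong (λ v →
    cong₂ (λ x y → ⟦ x ∧ (adj G u v ∧ y) ⟧) (hA u) (hB v)))

  e-congʳ : ∀ (A : VSet) {B B' : VSet} → B ≐ B' → e A B ≡ e A B'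
  e-congʳ A = e-cong {A} {A} (λ _ → refl)

  e-congˡ : ∀ {A A' : VSet} (B : VSet) → A ≐ A' → e A B ≡ e A' B
  e-congˡ B h = e-cong {B = B} {B} h (λ _ → refl)

  e-eInto : ∀ (A B : VSet) → e A B ≡ sumFin (eInto A B)
  e-eInto A B = sum-swap (λ u v → ⟦ A u ∧ (adj G u v ∧ B v) ⟧)

  e-sym : ∀ (A B : VSet) → e A B ≡ e B A
  e-sym A B = trans (e-eInto A B) (sum-cong (λ v → sum-cong (λ u →
    trans (cong (λ z → ⟦ A u ∧ (z ∧ B v) ⟧) (Graph.sym G u v)) (swap (A u) (adj G v u) (B v)))))
    where
    swap : ∀ x y z → ⟦ x ∧ (y ∧ z) ⟧ ≡ ⟦ z ∧ (y ∧ x) ⟧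
    swap false false false = refl
    swap false false true = refl
    swap false true false = refl
    swap false true true = refl
    swap true false false = refl
    swap true false true = refl
    swap true true false = refl
    swap true true true = refl

  e-splitʳ : ∀ (A B C : VSet) → e A B ≡ e A (λ v → B v ∧ C v) + e A (λ v → B v ∧ not (C v))
  e-splitʳ A B C = trans (sum-cong (λ u → trans (sum-cong (λ v → split (A u) (adj G u v) (B v) (C v)))
                                                 (sum-+ (term u (λ v → B v ∧ C v)) (term u (λ v → B v ∧ not (C v))))))
                         (sum-+ (λ u → sumFin (term u (λ v → B v ∧ C v))) (λ u → sumFin (term u (λ v → B v ∧ not (C v)))))
    where
    term : Fin N → VSet → Fin N → ℕ
    term u B' v = ⟦ A u ∧ (adj G u v ∧ B' v) ⟧
    split : ∀ x y z c → ⟦ x ∧ (y ∧ z) ⟧ ≡ ⟦ x ∧ (y ∧ (z ∧ c)) ⟧ + ⟦ x ∧ (y ∧ (z ∧ not c)) ⟧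
    split false y z c = refl
    split true false z c = refl
    split true true false c = refl
    split true true true false = refl
    split true true true true = refl

  e-splitˡ : ∀ (A B C : VSet) → e A B ≡ e (λ u → A u ∧ C u) B + e (λ u → A u ∧ not (C u)) B
  e-splitˡ A B C = begin
    e A B ≡⟨ e-sym A B ⟩
    e B A ≡⟨ e-splitʳ B A C ⟩
    e B (λ u → A u ∧ C u) + e B (λ u → A u ∧ not (C u))
      ≡⟨ cong₂ _+_ (e-sym B (λ u → A u ∧ C u)) (e-sym B (λ u → A u ∧ not (C u))) ⟩
    e (λ u → A u ∧ C u) B + e (λ u → A u ∧ not (C u)) B ∎
    where open ≡-Reasoning

  e-monoʳ : ∀ (A : VSet) {B B' : VSet} → B ⊆ᵇ B' → e A B ≤ e A B'
  e-monoʳ A h = sum-mono (λ u → sum-mono (λ v → mono (A u) (adj G u v) (h v)))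
    where
    mono : ∀ x y {z z'} → (z ≡ true → z' ≡ true) → ⟦ x ∧ (y ∧ z) ⟧ ≤ ⟦ x ∧ (y ∧ z') ⟧
    mono false y h = z≤n
    mono true false h = z≤n
    mono true true h = ⟦⟧-mono h

  eFrom-pos : ∀ (A B : VSet) u v → A u ≡ true → adj G u v ≡ true → B v ≡ true → 1 ≤ eFrom A B u
  eFrom-pos A B u v au uv bv =
    ≤-trans (≤-reflexive (cong ⟦_⟧ (sym (cong₂ _∧_ au (cong₂ _∧_ uv bv))))) (sum-single _ v)

  eFrom≤e : ∀ (A B : VSet) u → eFrom A B u ≤ e A B
  eFrom≤e A B u = sum-single (eFrom A B) u

  eInto≤e : ∀ (A B : VSet) v → eInto A B v ≤ e A B
  eInto≤e A B v = ≤-trans (sum-single (eInto A B) v) (≤-reflexive (sym (e-eInto A B)))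

  eInto-in : ∀ (A B : VSet) v → B v ≡ true → eInto A B v ≡ nbrsIn A v
  eInto-in A B v bv = sum-cong (λ u → cong (λ z → ⟦ A u ∧ z ⟧) (trans (cong (adj G u v ∧_) bv) (∧-identityʳ _)))

  nbrsIn≤e : ∀ (A B : VSet) s → B s ≡ true → nbrsIn A s ≤ e A B
  nbrsIn≤e A B s bs = ≤-trans (≤-reflexive (sym (eInto-in A B s bs))) (eInto≤e A B s)

  eInto-out : ∀ (A B : VSet) v → B v ≡ false → eInto A B v ≡ 0
  eInto-out A B v bv = sum-zero _ (λ u →
    cong ⟦_⟧ (trans (cong (λ z → A u ∧ z) (trans (cong (adj G u v ∧_) bv) (∧-zeroʳ _))) (∧-zeroʳ (A u))))

  nbrsIn-split : ∀ (A C : VSet) s → nbrsIn A s ≡ nbrsIn (λ u → A u ∧ C u) s + nbrsIn (λ u → A u ∧ not (C u)) s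
  nbrsIn-split A C s = trans (sum-cong (λ u → split (A u) (C u) (adj G u s)))
                             (sum-+ (λ u → ⟦ (A u ∧ C u) ∧ adj G u s ⟧) (λ u → ⟦ (A u ∧ not (C u)) ∧ adj G u s ⟧))
    where
    split : ∀ x c y → ⟦ x ∧ y ⟧ ≡ ⟦ (x ∧ c) ∧ y ⟧ + ⟦ (x ∧ not c) ∧ y ⟧
    split false c y = refl
    split true false y = refl
    split true true false = refl
    split true true true = refl

  nbrsIn-cong : ∀ {A A' : VSet} s → A ≐ A' → nbrsIn A s ≡ nbrsIn A' s
  nbrsIn-cong s h = sum-cong (λ u → cong (λ z → ⟦ z ∧ adj G u s ⟧) (h u))

  eFrom≤degree : ∀ (A B : VSet) u → eFrom A B u ≤ degree G u
  eFrom≤degree A B u = ≤-trans (sum-mono (λ v → drop (A u) (adj G u v) (B v)))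
                               (≤-reflexive (sym (card-tab (adj G u))))
    where
    drop : ∀ x y z → ⟦ x ∧ (y ∧ z) ⟧ ≤ ⟦ y ⟧
    drop false y z = z≤n
    drop true false z = z≤n
    drop true true false = z≤n
    drop true true true = ≤-refl

  singleton : Fin N → VSet
  singleton x i = i ≡ᵇ x

  e-singleton≤degree : ∀ (A : VSet) x → e A (singleton x) ≤ degree G x
  e-singleton≤degree A x = begin
    e A (singleton x)      ≡⟨ e-sym A (singleton x) ⟩
    e (singleton x) A      ≡⟨ sum-delta (eFrom (singleton x) A) x away ⟩
    eFrom (singleton x) A x ≤⟨ eFrom≤degree (singleton x) A x ⟩
    degree G x ∎
    where
    open ≤-Reasoning
    away : ∀ i → ¬ i ≡ x → eFrom (singleton x) A i ≡ 0
    away i i≢x = sum-zero _ (λ v → cong (λ z → ⟦ z ∧ (adj G i v ∧ A v) ⟧) (≡ᵇ-false i x i≢x))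

  ∂≤degree*card : ∀ d → (∀ u → degree G u ≤ d) → ∀ (U : VSet) → ∂ U ≤ d * card U
  ∂≤degree*card d deg≤d U = ≤-trans (sum-mono bound) (≤-reflexive (sum-scale d (λ u → ⟦ U u ⟧)))
    where
    bound : ∀ u → eFrom U (compl U) u ≤ d * ⟦ U u ⟧
    bound u with U u
    ... | true = ≤-trans (eFrom≤degree (λ _ → true) (compl U) u)
                         (≤-trans (deg≤d u) (≤-reflexive (sym (*-identityʳ d))))
    ... | false = ≤-reflexive (trans (sum-zero (λ v → ⟦ false ∧ (adj G u v ∧ not (U v)) ⟧) (λ v → refl))
                                     (sym (*-zeroʳ d)))

  boundarySize≡∂ : ∀ (f : VSet) → boundarySize G (tabulate f) ≡ ∂ f
  boundarySize≡∂ f = trans (sum-cong (λ u → card-tab (λ v → lookup (tabulate f) u ∧ (adj G u v ∧ not (lookup (tabulate f) v)))))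
                           (e-cong (lookup∘tabulate f) (λ i → cong not (lookup∘tabulate f i)))

all-or-witness : ∀ {m} {A : Fin m → Set} {B : Set} → (∀ i → A i ⊎ B) → (∀ i → A i) ⊎ B
all-or-witness {zero} h = inj₁ (λ ())
all-or-witness {suc m} {A} h with h F.zero
... | inj₂ b = inj₂ b
... | inj₁ a with all-or-witness {m} {λ i → A (F.suc i)} (λ i → h (F.suc i))
...   | inj₂ b = inj₂ b
...   | inj₁ f = inj₁ (λ { F.zero → a ; (F.suc i) → f i })

module Connectivity (G : Graph) where
  open Counting G

  walk-start : ∀ {T u v} → WalkIn G T u v → u ∈ T
  walk-start (here u∈T) = u∈T
  walk-start (step u∈T _ _) = u∈T

  crossing-edge : ∀ {T u v} → WalkIn G T u v → (Y : VSet) → Y u ≡ true → Y v ≡ false →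
    Σ (Fin N) λ a → Σ (Fin N) λ b →
      (a ∈ T) × (b ∈ T) × (Y a ≡ true) × (Y b ≡ false) × (adj G a b ≡ true)
  crossing-edge (here _) Y yu yv = false≢true (trans (sym yv) yu)
  crossing-edge {u = u} (step {w = w} u∈T uw walk) Y yu yv with Y w in yw
  ... | true = crossing-edge walk Y yw yv
  ... | false = u , w , u∈T , walk-start walk , yu , yw , uw

  Split : VSet → Set
  Split T = Σ VSet λ X → (X ⊆ᵇ T) × (∃ λ i → X i ≡ true) × (∃ λ i → T i ∧ not (X i) ≡ true) ×
                          (e X (λ i → T i ∧ not (X i)) ≡ 0)

  Split-cong : ∀ {A B : VSet} → A ≐ B → Split A → Split B
  Split-cong {A} {B} A≐B (X , X⊆A , inX , (j , outX) , none) =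
    X , (λ i xi → trans (sym (A≐B i)) (X⊆A i xi)) , inX ,
    (j , trans (cong (λ z → z ∧ not (X j)) (sym (A≐B j))) outX) ,
    trans (e-congʳ X (λ i → cong (λ z → z ∧ not (X i)) (sym (A≐B i)))) none

  -- The chain
  -- R 0 ⊆ R 1 ⊆ … grows strictly until it is closed under neighbours in T, so
  -- it becomes closed after at most |V| steps.
  module Reachability (T : Subset N) (v : Fin N) (v∈T : lookup T v ≡ true) where
    inT : VSet
    inT = lookup T

    R : ℕ → VSet
    R zero w = w ≡ᵇ v
    R (suc k) w = R k w ∨ (inT w ∧ anyᵇ (λ y → adj G w y ∧ R k y))

    R-v : ∀ k → R k v ≡ true
    R-v zero = ≡ᵇ-refl v
    R-v (suc k) rewrite R-v k = refl

    R-mono : ∀ k w → R k w ≡ true → R (suc k) w ≡ true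
    R-mono k w h rewrite h = refl

    R-walk : ∀ k w → R k w ≡ true → WalkIn G T w v
    R-walk zero w h rewrite ≡ᵇ-sound w v h = here (→mem v∈T)
    R-walk (suc k) w h with R k w in rk | inT w in tw | h
    ... | true | _ | _ = R-walk k w rk
    ... | false | true | h' with anyᵇ-sound (λ y → adj G w y ∧ R k y) h'
    ...   | y , hy with adj G w y in wy | R k y in ry | hy
    ...     | true | true | _ = step (→mem tw) wy (R-walk k y ry)

    R⊆T : ∀ k → R k ⊆ᵇ inT
    R⊆T k w h = walk-in-T (R-walk k w h)
      where
      walk-in-T : ∀ {w} → WalkIn G T w v → inT w ≡ true
      walk-in-T walk = mem→ (walk-start walk)

    Closed : VSet → Set
    Closed X = ∀ w y → inT w ≡ true → adj G w y ≡ true → X y ≡ true → X w ≡ true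

    violates : VSet → Fin N → Fin N → Bool
    violates X w y = inT w ∧ (adj G w y ∧ (X y ∧ not (X w)))

    closed-or-violation : ∀ X → Closed X ⊎ (Σ (Fin N) λ w → Σ (Fin N) λ y → violates X w y ≡ true)
    closed-or-violation X with anyᵇ (λ w → anyᵇ (λ y → violates X w y)) in any
    ... | true with anyᵇ-sound _ any
    ...   | w , h with anyᵇ-sound _ h
    ...     | y , h' = inj₂ (w , y , h')
    closed-or-violation X | false = inj₁ closed
      where
      closed : Closed X
      closed w y tw wy xy with X w in xw
      ... | true = refl
      ... | false = false≢true (trans (sym any)
                      (anyᵇ-complete _ w (anyᵇ-complete (violates X w) y violation)))
        where
        violation : violates X w y ≡ true
        violation rewrite tw | wy | xy | xw = refl

    grows : ∀ k w y → violates (R k) w y ≡ true → card (R k) < card (R (suc k))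
    grows k w y h = sum-strict (λ i → ⟦⟧-mono (R-mono k i)) w (new h)
      where
      new : violates (R k) w y ≡ true → ⟦ R k w ⟧ < ⟦ R (suc k) w ⟧
      new h with inT w | adj G w y in wy | R k y in ry | R k w | h
      ... | true | true | true | false | _
        rewrite anyᵇ-complete (λ y' → adj G w y' ∧ R k y') y (cong₂ _∧_ wy ry) = s≤s z≤n

    closed-or-large : ∀ k → (∃ λ j → Closed (R j)) ⊎ (k < card (R k))
    closed-or-large zero = inj₂ (card-pos (R zero) v (≡ᵇ-refl v))
    closed-or-large (suc k) with closed-or-large k
    ... | inj₁ done = inj₁ done
    ... | inj₂ k<card with closed-or-violation (R k)
    ...   | inj₁ closed = inj₁ (k , closed)
    ...   | inj₂ (w , y , h) = inj₂ (≤-trans (s≤s k<card) (grows k w y h))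

    stabilises : ∃ λ j → Closed (R j)
    stabilises with closed-or-large N
    ... | inj₁ done = done
    ... | inj₂ N<card = ⊥-elim (<⇒≱ N<card (card-bound (R N)))

  connected-or-split : (T : Subset N) → ConnectedOn G T ⊎ Split (lookup T)
  connected-or-split T with all-or-witness {N} {λ v → ∀ u → u ∈ T → v ∈ T → WalkIn G T u v} reach
    where
    reach : ∀ v → (∀ u → u ∈ T → v ∈ T → WalkIn G T u v) ⊎ Split (lookup T)
    reach v with lookup T v in vt
    ... | false = inj₁ (λ _ _ v∈T → false≢true (trans (sym vt) (mem→ v∈T)))
    ... | true with Reachability.stabilises T v vt
    ...   | j , closed with anyᵇ (λ u → lookup T u ∧ not (R j u)) in missing
      where open Reachability T v vt
    ...     | false = inj₁ (λ u u∈T _ → R-walk j u (reached u (mem→ u∈T)))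
      where
      open Reachability T v vt
      reached : ∀ u → lookup T u ≡ true → R j u ≡ true
      reached u tu with R j u in ru
      ... | true = refl
      ... | false = false≢true (trans (sym missing) (anyᵇ-complete _ u (cong₂ (λ a b → a ∧ not b) tu ru)))
    ...     | true = inj₂ (R j , R⊆T j , (v , R-v j) , anyᵇ-sound _ missing , no-edge)
      where
      open Reachability T v vt
      no-edge : e (R j) (λ i → lookup T i ∧ not (R j i)) ≡ 0
      no-edge = trans (e-sym (R j) _) (sum-zero _ (λ w → sum-zero _ (λ y → term w y)))
        where
        term : ∀ w y → ⟦ (lookup T w ∧ not (R j w)) ∧ (adj G w y ∧ R j y) ⟧ ≡ 0
        term w y with lookup T w in tw | R j w in rw | adj G w y in wy | R j y in ry
        ... | true | false | true | true = false≢true (trans (sym rw) (closed w y tw wy ry))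
        ... | false | _ | _ | _ = refl
        ... | true | true | _ | _ = refl
        ... | true | false | false | _ = refl
        ... | true | false | true | false = refl
  ... | inj₁ all = inj₁ (λ u v u∈T v∈T → all v u u∈T v∈T)
  ... | inj₂ split = inj₂ split

∧-not : ∀ a b → a ∧ not b ≡ true → (a ≡ true) × (b ≡ false)
∧-not true false _ = refl , refl

≡ᵇ-false⇒≢ : ∀ {m} (i j : Fin m) → i ≡ᵇ j ≡ false → ¬ i ≡ j
≡ᵇ-false⇒≢ i .i h refl = false≢true (trans (sym h) (≡ᵇ-refl i))

∈⊤-minus : ∀ {m} (x i : Fin m) → i ≡ᵇ x ≡ false → i ∈ (⊤ - x)
∈⊤-minus x i h = →mem (trans (lookup-minus ⊤ x i) (cong₂ (λ p q → p ∧ not q) (lookup-⊤ i) h))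

∈⊤-minus⇒≢ : ∀ {m} (x i : Fin m) → i ∈ (⊤ - x) → ¬ i ≡ x
∈⊤-minus⇒≢ x i i∈ = ≡ᵇ-false⇒≢ i x (proj₂ (∧-not _ _ (trans (sym (lookup-minus ⊤ x i)) (mem→ i∈))))

-- In a 2-connected graph of minimum degree ≥ 2 every nontrivial edge cut has
-- at least two edges: a walk leaves Y along an edge ab, and unless Y = {a} a
-- second walk avoiding a leaves Y along an edge a'b' with a' ≠ a.
module EdgeCuts (G : Graph) (tc : TwoConnected G) (deg≥2 : ∀ u → 2 ≤ degree G u) where
  open Counting G
  open Connectivity G

  separated : ∀ (Y : VSet) {a b} → Y a ≡ true → Y b ≡ false → b ≡ᵇ a ≡ false
  separated Y {a} {b} ya yb = dec-false (b F.≟ a) (λ { refl → false≢true (trans (sym yb) ya) })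

  ∂≥2 : ∀ (Y : VSet) → (∃ λ i → Y i ≡ true) → (∃ λ j → Y j ≡ false) → 2 ≤ ∂ Y
  ∂≥2 Y (y , yy) (z , yz)
    with crossing-edge (proj₁ (proj₂ tc) y z (→mem (lookup-⊤ y)) (→mem (lookup-⊤ z))) Y yy yz
  ... | a , b , _ , _ , ya , yb , ab with anyᵇ (λ i → Y i ∧ not (i ≡ᵇ a)) in other
  ...   | false = begin
      2                                  ≤⟨ deg≥2 a ⟩
      degree G a                         ≡⟨ card-tab (adj G a) ⟩
      sumFin (λ v → ⟦ adj G a v ⟧)        ≡⟨ sum-cong all-leave ⟨
      eFrom Y (compl Y) a                ≤⟨ eFrom≤e Y (compl Y) a ⟩
      ∂ Y ∎
    where
    open ≤-Reasoning
    only-a : ∀ i → Y i ≡ true → i ≡ a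
    only-a i yi with i ≡ᵇ a in ia
    ... | true = ≡ᵇ-sound i a ia
    ... | false = false≢true (trans (sym other) (anyᵇ-complete _ i (cong₂ (λ p q → p ∧ not q) yi ia)))
    -- here Y = {a}, so every edge at a leaves Y
    all-leave : ∀ v → ⟦ Y a ∧ (adj G a v ∧ not (Y v)) ⟧ ≡ ⟦ adj G a v ⟧
    all-leave v with adj G a v in av | Y v in yv
    ... | false | _ = cong ⟦_⟧ (∧-zeroʳ (Y a))
    ... | true | false = cong ⟦_⟧ (trans (∧-identityʳ (Y a)) ya)
    ... | true | true with only-a v yv
    ...   | refl = false≢true (trans (sym (irrefl G a)) av)
  ...   | true with anyᵇ-sound (λ i → Y i ∧ not (i ≡ᵇ a)) other
  ...     | y₁ , h with ∧-not (Y y₁) (y₁ ≡ᵇ a) h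
  ...       | y₁∈Y , y₁≢a
              with crossing-edge (proj₂ (proj₂ tc) a (→mem (lookup-⊤ a)) y₁ b
                                    (∈⊤-minus a y₁ y₁≢a) (∈⊤-minus a b (separated Y ya yb)))
                                 Y y₁∈Y yb
  ...         | a' , b' , a'∈ , _ , ya' , yb' , a'b' =
                sum-two (eFrom Y (compl Y)) a a' (λ a≡a' → ∈⊤-minus⇒≢ a a' a'∈ (sym a≡a'))
                  (eFrom-pos Y (compl Y) a b ya ab (cong not yb))
                  (eFrom-pos Y (compl Y) a' b' ya' a'b' (cong not yb'))

module WeakSplits (G : Graph) (deg≤3 : ∀ u → degree G u ≤ 3) where
  open Counting G
  open Connectivity G

  S : VSet → Subset N
  S U = ∁ (tabulate U)

  S≐ : ∀ U → lookup (S U) ≐ compl U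
  S≐ U i = trans (lookup-∁ (tabulate U) i) (cong not (lookup∘tabulate U i))

  WeakSplit : VSet → Set
  WeakSplit T = Σ VSet λ X → (X ⊆ᵇ T) × (∃ λ i → X i ≡ true) × (∃ λ i → T i ∧ not (X i) ≡ true) ×
                              (e X (λ i → T i ∧ not (X i)) ≤ 1)

  Split⇒WeakSplit : ∀ {T} → Split T → WeakSplit T
  Split⇒WeakSplit (X , X⊆T , inX , outX , none) = X , X⊆T , inX , outX , ≤-trans (≤-reflexive none) z≤n

  -- A split {X, Y} of T − x gives a weak split of T: since x has at most
  -- three neighbours, one side Z sends at most one edge to x, and then
  -- Z has at most one edge to T ∖ Z.
  module SplitMinusVertex (T : VSet) (x : Fin N) (x∈T : T x ≡ true) where
    T-x : VSet
    T-x i = T i ∧ not (i ≡ᵇ x)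

    side : ∀ (Z : VSet) → Z ⊆ᵇ T-x → (∃ λ i → Z i ≡ true) → e Z (λ i → T-x i ∧ not (Z i)) ≡ 0 →
           e Z (singleton x) ≤ 1 → WeakSplit T
    side Z Z⊆ inZ none toX≤1 = Z , Z⊆T , inZ , (x , x-outside) , few
      where
      Z⊆T : Z ⊆ᵇ T
      Z⊆T i zi = proj₁ (∧-not (T i) (i ≡ᵇ x) (Z⊆ i zi))
      x∉Z : Z x ≡ false
      x∉Z with Z x in zx
      ... | false = refl
      ... | true = false≢true (trans (sym (proj₂ (∧-not (T x) (x ≡ᵇ x) (Z⊆ x zx)))) (≡ᵇ-refl x))
      x-outside : T x ∧ not (Z x) ≡ true
      x-outside rewrite x∈T | x∉Z = refl
      at-x : (λ i → (T i ∧ not (Z i)) ∧ (i ≡ᵇ x)) ≐ singleton x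
      at-x i with i ≡ᵇ x in ix
      ... | false = ∧-zeroʳ _
      ... | true rewrite ≡ᵇ-sound i x ix | x∈T | x∉Z = refl
      away-from-x : (λ i → (T i ∧ not (Z i)) ∧ not (i ≡ᵇ x)) ≐ (λ i → T-x i ∧ not (Z i))
      away-from-x i with T i | Z i | i ≡ᵇ x
      ... | false | _ | _ = refl
      ... | true | true | true = refl
      ... | true | true | false = refl
      ... | true | false | true = refl
      ... | true | false | false = refl
      few : e Z (λ i → T i ∧ not (Z i)) ≤ 1
      few = begin
        e Z (λ i → T i ∧ not (Z i))
          ≡⟨ e-splitʳ Z (λ i → T i ∧ not (Z i)) (singleton x) ⟩
        e Z (λ i → (T i ∧ not (Z i)) ∧ (i ≡ᵇ x)) + e Z (λ i → (T i ∧ not (Z i)) ∧ not (i ≡ᵇ x))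
          ≡⟨ cong₂ _+_ (e-congʳ Z at-x) (trans (e-congʳ Z away-from-x) none) ⟩
        e Z (singleton x) + 0
          ≡⟨ +-identityʳ _ ⟩
        e Z (singleton x)
          ≤⟨ toX≤1 ⟩
        1 ∎
        where open ≤-Reasoning

    fromSplit : Split T-x → WeakSplit T
    fromSplit (X , X⊆ , inX , (j , outX) , none) with e X (singleton x) ≤? 1
    ... | yes X-few = side X X⊆ inX none X-few
    ... | no X-many = side Y Y⊆ (j , outX) none-Y Y-few
      where
      Y : VSet
      Y i = T-x i ∧ not (X i)
      Y⊆ : Y ⊆ᵇ T-x
      Y⊆ i yi = proj₁ (∧-not (T-x i) (X i) yi)
      rest-of-Y : (λ i → T-x i ∧ not (Y i)) ≐ X
      rest-of-Y i with X i in xi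
      ... | true rewrite X⊆ i xi = refl
      ... | false with T-x i
      ...   | true = refl
      ...   | false = refl
      none-Y : e Y (λ i → T-x i ∧ not (Y i)) ≡ 0
      none-Y = trans (e-congʳ Y rest-of-Y) (trans (e-sym Y X) none)
      X∪Y-at-X : (λ i → (X i ∨ Y i) ∧ X i) ≐ X
      X∪Y-at-X i with X i
      ... | true = refl
      ... | false = ∧-zeroʳ _
      X∪Y-off-X : (λ i → (X i ∨ Y i) ∧ not (X i)) ≐ Y
      X∪Y-off-X i with X i | T-x i
      ... | true | _ = sym (∧-zeroʳ _)
      ... | false | true = refl
      ... | false | false = refl
      both≤3 : e X (singleton x) + e Y (singleton x) ≤ 3
      both≤3 = begin
        e X (singleton x) + e Y (singleton x)
          ≡⟨ cong₂ _+_ (e-congˡ (singleton x) X∪Y-at-X) (e-congˡ (singleton x) X∪Y-off-X) ⟨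
        e (λ i → (X i ∨ Y i) ∧ X i) (singleton x) + e (λ i → (X i ∨ Y i) ∧ not (X i)) (singleton x)
          ≡⟨ e-splitˡ (λ i → X i ∨ Y i) (singleton x) X ⟨
        e (λ i → X i ∨ Y i) (singleton x)
          ≤⟨ e-singleton≤degree (λ i → X i ∨ Y i) x ⟩
        degree G x
          ≤⟨ deg≤3 x ⟩
        3 ∎
        where open ≤-Reasoning
      Y-few : e Y (singleton x) ≤ 1
      Y-few = +-cancelˡ-≤ 2 _ _ (≤-trans (+-monoˡ-≤ (e Y (singleton x)) (≰⇒> X-many)) both≤3)

  data Outcome (U : VSet) : Set where
    complement-empty       : Empty (∁ (tabulate U)) → Outcome U
    complement-2-connected : TwoConnectedOn G (∁ (tabulate U)) → Outcome U
    complement-tiny        : 1 ≤ card (compl U) → card (compl U) ≤ 2 → Outcome U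
    complement-weak-split  : WeakSplit (compl U) → Outcome U

  -- If |V ∖ U| > 2 but G[V ∖ U] is not 2-connected, then V ∖ U or some
  -- V ∖ U − x has a split, and either yields a weak split of V ∖ U.
  outcome : ∀ (U : VSet) → Outcome U
  outcome U with card (compl U) ≤? 2
  ... | yes ≤2 with card (compl U) ≟ 0
  ...   | yes ≡0 = complement-empty (λ (f , f∈) → <⇒≱ (card-pos (compl U) f (trans (sym (S≐ U f)) (mem→ f∈)))
                                                         (≤-reflexive ≡0))
  ...   | no ≢0 = complement-tiny (n≢0⇒n>0 ≢0) ≤2
  outcome U | no >2 with connected-or-split (S U)
  ... | inj₂ split = complement-weak-split (Split⇒WeakSplit (Split-cong (S≐ U) split))
  ... | inj₁ connected with all-or-witness {N} {λ x → x ∈ S U → ConnectedOn G (S U - x)} minus-vertex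
    where
    minus-vertex : ∀ x → (x ∈ S U → ConnectedOn G (S U - x)) ⊎ WeakSplit (compl U)
    minus-vertex x with lookup (S U) x in sx
    ... | false = inj₁ (λ x∈S → false≢true (trans (sym sx) (mem→ x∈S)))
    ... | true with connected-or-split (S U - x)
    ...   | inj₁ c = inj₁ (λ _ → c)
    ...   | inj₂ split = inj₂ (SplitMinusVertex.fromSplit (compl U) x (trans (sym (S≐ U x)) sx)
                                 (Split-cong (λ i → trans (lookup-minus (S U) x i) (cong (_∧ not (i ≡ᵇ x)) (S≐ U i))) split))
  ...   | inj₁ all-connected = complement-2-connected (|S|>2 , connected , all-connected)
    where
    |S|>2 : 2 < ∣ S U ∣
    |S|>2 = subst (2 <_) (sym (trans (card-vec (S U)) (card-cong (S≐ U)))) (≰⇒> >2)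
  ...   | inj₂ weak = complement-weak-split weak

module PotentialArithmetic where
  open +-*-Solver

  -- Absorbing X with m edges from U and k ≤ 1 < m edges onwards: ∂ drops by
  -- d = m − k ≥ 1, |X| ≤ q(m + k) ≤ 3qd and #attached rises by ≤ k, so Φ
  -- drops as soon as A > 3(q + B).
  decrease-when-∂-drops : ∀ q B ∂ ∂' m k cU cX l l' → ∂' + m ≡ ∂ + k → k < m → k ≤ 1 →
    cX ≤ q * (m + k) → l' ≤ l + k →
    suc (3 * (q + B)) * ∂' + (cU + cX) + B * l' < suc (3 * (q + B)) * ∂ + cU + B * l
  decrease-when-∂-drops q B ∂ ∂' m k cU cX l l' balance k<m k≤1 cX≤ l'≤
    with m ∸ k | m∸n+n≡m {m} {k} (<⇒≤ k<m)
  ... | d | d+k≡m = begin-strict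
      A * ∂' + (cU + cX) + B * l'
        ≤⟨ +-monoʳ-≤ (A * ∂' + (cU + cX)) (*-monoʳ-≤ B l'≤) ⟩
      A * ∂' + (cU + cX) + B * (l + k)
        ≡⟨ solve 7 (λ A ∂' cU cX B l k → A :* ∂' :+ (cU :+ cX) :+ B :* (l :+ k)
                      := (A :* ∂' :+ cU :+ B :* l) :+ (cX :+ B :* k)) refl A ∂' cU cX B l k ⟩
      (A * ∂' + cU + B * l) + (cX + B * k)
        <⟨ +-monoʳ-< (A * ∂' + cU + B * l) extra<A*d ⟩
      (A * ∂' + cU + B * l) + A * d
        ≡⟨ solve 6 (λ A ∂' cU B l d → (A :* ∂' :+ cU :+ B :* l) :+ A :* d
                      := A :* (∂' :+ d) :+ cU :+ B :* l) refl A ∂' cU B l d ⟩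
      A * (∂' + d) + cU + B * l
        ≡⟨ cong (λ z → A * z + cU + B * l) ∂≡∂'+d ⟨
      A * ∂ + cU + B * l ∎
    where
    open ≤-Reasoning
    A = suc (3 * (q + B))
    d≥1 : 1 ≤ d
    d≥1 = +-cancelʳ-≤ k 1 d (≤-trans k<m (≤-reflexive (sym d+k≡m)))
    ∂≡∂'+d : ∂ ≡ ∂' + d
    ∂≡∂'+d = +-cancelʳ-≡ k ∂ (∂' + d)
      (trans (sym balance) (trans (cong (∂' +_) (sym d+k≡m)) (sym (+-assoc ∂' d k))))
    m+k≤3d : m + k ≤ 3 * d
    m+k≤3d = begin
      m + k       ≡⟨ cong (_+ k) d+k≡m ⟨
      d + k + k   ≤⟨ +-mono-≤ (+-monoʳ-≤ d (≤-trans k≤1 d≥1)) (≤-trans k≤1 d≥1) ⟩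
      d + d + d   ≡⟨ solve 1 (λ d → d :+ d :+ d := con 3 :* d) refl d ⟩
      3 * d ∎
    extra<A*d : cX + B * k < A * d
    extra<A*d = begin-strict
      cX + B * k                  ≤⟨ +-mono-≤ cX≤ (*-monoʳ-≤ B (m≤n+m k m)) ⟩
      q * (m + k) + B * (m + k)   ≡⟨ *-distribʳ-+ (m + k) q B ⟨
      (q + B) * (m + k)           ≤⟨ *-monoʳ-≤ (q + B) m+k≤3d ⟩
      (q + B) * (3 * d)           ≡⟨ solve 3 (λ q B d → (q :+ B) :* (con 3 :* d) := con 3 :* (q :+ B) :* d)
                                       refl q B d ⟩
      3 * (q + B) * d             <⟨ +-monoˡ-≤ (3 * (q + B) * d) d≥1 ⟩
      d + 3 * (q + B) * d ∎

  -- Absorbing a blob X (|X| < B) keeps ∂ and lowers #attached: Φ drops.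
  decrease-when-attached-drops : ∀ A B ∂ cU cX l l' → cX < B → l' < l →
    A * ∂ + (cU + cX) + B * l' < A * ∂ + cU + B * l
  decrease-when-attached-drops A B ∂ cU cX l l' cX<B l'<l = begin-strict
      A * ∂ + (cU + cX) + B * l'
        ≡⟨ solve 6 (λ A ∂ cU cX B l' → A :* ∂ :+ (cU :+ cX) :+ B :* l' := A :* ∂ :+ cU :+ (cX :+ B :* l'))
                   refl A ∂ cU cX B l' ⟩
      A * ∂ + cU + (cX + B * l')   <⟨ +-monoʳ-< (A * ∂ + cU) (+-monoˡ-< (B * l') cX<B) ⟩
      A * ∂ + cU + (B + B * l')    ≡⟨ cong (A * ∂ + cU +_) (*-suc B l') ⟨
      A * ∂ + cU + B * suc l'      ≤⟨ +-monoʳ-≤ (A * ∂ + cU) (*-monoʳ-≤ B l'<l) ⟩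
      A * ∂ + cU + B * l ∎
    where open ≤-Reasoning

  initial-bound : ∀ A B ∂ c l → ∂ ≤ 3 * c → l ≤ ∂ → A * ∂ + c + B * l ≤ suc (3 * A + 3 * B) * c
  initial-bound A B ∂ c l ∂≤ l≤ = begin
      A * ∂ + c + B * l             ≤⟨ +-mono-≤ (+-monoˡ-≤ c (*-monoʳ-≤ A ∂≤)) (*-monoʳ-≤ B (≤-trans l≤ ∂≤)) ⟩
      A * (3 * c) + c + B * (3 * c) ≡⟨ solve 3 (λ A B c → A :* (con 3 :* c) :+ c :+ B :* (con 3 :* c)
                                          := (con 1 :+ (con 3 :* A :+ con 3 :* B)) :* c) refl A B c ⟩
      suc (3 * A + 3 * B) * c ∎
    where open ≤-Reasoning

complement-small : ∀ a b n → a + b ≤ n → n < 2 * a → 2 * b ≤ n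
complement-small a b n a+b≤n n<2a = <⇒≤ (+-cancelʳ-≤ n (suc (2 * b)) n (begin
    suc (2 * b) + n   ≡⟨ +-suc (2 * b) n ⟨
    2 * b + suc n     ≤⟨ +-monoʳ-≤ (2 * b) n<2a ⟩
    2 * b + 2 * a     ≡⟨ *-distribˡ-+ 2 b a ⟨
    2 * (b + a)       ≤⟨ *-monoʳ-≤ 2 (≤-trans (≤-reflexive (+-comm b a)) a+b≤n) ⟩
    2 * n             ≡⟨ cong (n +_) (+-identityʳ n) ⟩
    n + n ∎))
  where open ≤-Reasoning

module Moves (G : Graph) where
  open Counting G

  rest : VSet → VSet → VSet
  rest U X i = not (U i) ∧ not (X i)

  module Move (U X : VSet) (X⊆ : X ⊆ᵇ compl U) where
    disjoint : ∀ i → X i ≡ true → U i ≡ false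
    disjoint i xi with U i | X⊆ i xi
    ... | false | _ = refl

    ∪-on-U : (λ i → (U ∪ᵇ X) i ∧ U i) ≐ U
    ∪-on-U i with U i
    ... | true = refl
    ... | false = ∧-zeroʳ _

    ∪-off-U : (λ i → (U ∪ᵇ X) i ∧ not (U i)) ≐ X
    ∪-off-U i with U i in ui | X i in xi
    ... | true | true = false≢true (trans (sym (disjoint i xi)) ui)
    ... | true | false = refl
    ... | false | x = ∧-identityʳ x

    e-∪ : ∀ Y → e (U ∪ᵇ X) Y ≡ e U Y + e X Y
    e-∪ Y = trans (e-splitˡ (U ∪ᵇ X) Y U) (cong₂ _+_ (e-congˡ Y ∪-on-U) (e-congˡ Y ∪-off-U))

    nbrsIn-∪ : ∀ s → nbrsIn (U ∪ᵇ X) s ≡ nbrsIn U s + nbrsIn X s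
    nbrsIn-∪ s = trans (nbrsIn-split (U ∪ᵇ X) U s) (cong₂ _+_ (nbrsIn-cong s ∪-on-U) (nbrsIn-cong s ∪-off-U))

    card-∪ : card (U ∪ᵇ X) ≡ card U + card X
    card-∪ = trans (card-split (U ∪ᵇ X) U) (cong₂ _+_ (card-cong ∪-on-U) (card-cong ∪-off-U))

    compl-∪ : compl (U ∪ᵇ X) ≐ rest U X
    compl-∪ i with U i
    ... | true = refl
    ... | false = refl

    ∂U : ∂ U ≡ e U X + e U (rest U X)
    ∂U = trans (e-splitʳ U (compl U) X) (cong (_+ e U (rest U X)) (e-congʳ U X-in-compl))
      where
      X-in-compl : (λ i → compl U i ∧ X i) ≐ X
      X-in-compl i with X i in xi
      ... | true rewrite disjoint i xi = refl
      ... | false = ∧-zeroʳ _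

    ∂-after : ∂ (U ∪ᵇ X) + e U X ≡ ∂ U + e X (rest U X)
    ∂-after = begin
        ∂ (U ∪ᵇ X) + e U X
      ≡⟨ cong (_+ e U X) (trans (e-congʳ (U ∪ᵇ X) compl-∪) (e-∪ (rest U X))) ⟩
        e U (rest U X) + e X (rest U X) + e U X
      ≡⟨ +-assoc (e U (rest U X)) _ _ ⟩
        e U (rest U X) + (e X (rest U X) + e U X)
      ≡⟨ cong (e U (rest U X) +_) (+-comm (e X (rest U X)) (e U X)) ⟩
        e U (rest U X) + (e U X + e X (rest U X))
      ≡⟨ +-assoc (e U (rest U X)) _ _ ⟨
        e U (rest U X) + e U X + e X (rest U X)
      ≡⟨ cong (_+ e X (rest U X)) (trans (+-comm (e U (rest U X)) (e U X)) (sym ∂U)) ⟩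
        ∂ U + e X (rest U X) ∎
      where open ≡-Reasoning

    ∂X : ∂ X ≡ e U X + e X (rest U X)
    ∂X = trans (e-splitʳ X (compl X) U) (cong₂ _+_ (trans (e-congʳ X to-U) (e-sym X U)) (e-congʳ X to-rest))
      where
      to-U : (λ i → not (X i) ∧ U i) ≐ U
      to-U i with U i in ui | X i in xi
      ... | true | true = false≢true (trans (sym (disjoint i xi)) ui)
      ... | true | false = refl
      ... | false | x = ∧-zeroʳ _
      to-rest : (λ i → not (X i) ∧ not (U i)) ≐ rest U X
      to-rest i with U i | X i
      ... | true | true = refl
      ... | true | false = refl
      ... | false | true = refl
      ... | false | false = refl

  outside-∪ : ∀ (U X Y : VSet) → Y ⊆ᵇ compl (U ∪ᵇ X) → (Y ⊆ᵇ compl U) × (∀ i → Y i ≡ true → X i ≡ false)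
  outside-∪ U X Y Y⊆ = (λ i yi → not-U i (Y⊆ i yi)) , (λ i yi → not-X i (Y⊆ i yi))
    where
    not-U : ∀ i → not (U i ∨ X i) ≡ true → not (U i) ≡ true
    not-U i h with U i
    ... | false = refl
    not-X : ∀ i → not (U i ∨ X i) ≡ true → X i ≡ false
    not-X i h with U i | X i
    ... | false | false = refl

-- A blob of U is a nonempty X outside U
-- with 2|X| ≤ |V|, joined to U by exactly one edge and to the rest by exactly
-- one edge; absorbing it does not change ∂U, so the potential needs a second
-- term: the number of vertices adjacent to U that lie in some blob of U.
module Blobs (G : Graph) (q : ℕ)
    (expansion : ∀ (X : Counting.VSet G) → 1 ≤ Counting.card G X → 2 * Counting.card G X ≤ n G →
                 Counting.card G X ≤ q * Counting.∂ G X)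
    (large : 6 * q < n G) where
  open Counting G
  open Moves G

  Nonempty : VSet → Set
  Nonempty U = ∃ λ i → U i ≡ true

  Blob : VSet → VSet → Set
  Blob U X = (X ⊆ᵇ compl U) × (1 ≤ card X) × (2 * card X ≤ N) × (e U X ≡ 1) × (e X (rest U X) ≡ 1)

  subset? : ∀ (A B : VSet) → Dec (A ⊆ᵇ B)
  subset? A B = F.all? (λ i → (A i Bool.≟ true) →-dec (B i Bool.≟ true))

  blob? : ∀ U X → Dec (Blob U X)
  blob? U X = subset? X (compl U) ×-dec (1 ≤? card X) ×-dec (2 * card X ≤? N) ×-dec
              (e U X ≟ 1) ×-dec (e X (rest U X) ≟ 1)

  Blob-cong : ∀ {U X X'} → X ≐ X' → Blob U X → Blob U X'
  Blob-cong {U} {X} {X'} X≐X' (X⊆ , c≥1 , small , one-in , one-out) =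
    (λ i xi → X⊆ i (trans (X≐X' i) xi)) ,
    subst (1 ≤_) (card-cong X≐X') c≥1 ,
    subst (λ z → 2 * z ≤ N) (card-cong X≐X') small ,
    trans (sym (e-congʳ U X≐X')) one-in ,
    trans (sym (e-cong X≐X' (λ i → cong (λ z → not (U i) ∧ not z) (X≐X' i)))) one-out

  -- a blob has boundary 2, hence at most 2q vertices
  blob-size : ∀ U X → Blob U X → card X ≤ 2 * q
  blob-size U X (X⊆ , c≥1 , small , one-in , one-out) =
    ≤-trans (expansion X c≥1 small) (≤-reflexive (trans (cong (q *_) ∂X≡2) (*-comm q 2)))
    where
    ∂X≡2 : ∂ X ≡ 2
    ∂X≡2 = trans (Move.∂X U X X⊆) (cong₂ _+_ one-in one-out)

  InBlob : VSet → Fin N → Set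
  InBlob U s = Σ (Subset N) λ X → Blob U (lookup X) × lookup X s ≡ true

  inBlob? : ∀ U s → Dec (InBlob U s)
  inBlob? U s = anySubset? (λ X → blob? U (lookup X) ×-dec (lookup X s Bool.≟ true))

  inBlob-intro : ∀ {U X} s → Blob U X → X s ≡ true → InBlob U s
  inBlob-intro {U} {X} s b xs =
    tabulate X , Blob-cong (λ i → sym (lookup∘tabulate X i)) b , trans (lookup∘tabulate X s) xs

  attached : VSet → VSet
  attached U s = not (U s) ∧ (does (1 ≤? nbrsIn U s) ∧ does (inBlob? U s))

  #attached : VSet → ℕ
  #attached U = card (attached U)

  attached-intro : ∀ U s → U s ≡ false → 1 ≤ nbrsIn U s → InBlob U s → attached U s ≡ true
  attached-intro U s us a b rewrite us | dec-true (1 ≤? nbrsIn U s) a | dec-true (inBlob? U s) b = refl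

  attached-elim : ∀ U s → attached U s ≡ true → (U s ≡ false) × (1 ≤ nbrsIn U s) × InBlob U s
  attached-elim U s h with U s | does (1 ≤? nbrsIn U s) in a | does (inBlob? U s) in b | h
  ... | false | true | true | _ = refl , from-does (1 ≤? nbrsIn U s) a , from-does (inBlob? U s) b
    where
    from-does : ∀ {P : Set} (d : Dec P) → does d ≡ true → P
    from-does (yes p) _ = p

  -- every attached vertex receives a boundary edge of U
  #attached≤∂ : ∀ U → #attached U ≤ ∂ U
  #attached≤∂ U = ≤-trans (sum-mono pointwise) (≤-reflexive (sym (e-eInto U (compl U))))
    where
    pointwise : ∀ s → ⟦ attached U s ⟧ ≤ eInto U (compl U) s
    pointwise s with attached U s in at
    ... | false = z≤n
    ... | true with attached-elim U s at
    ...   | us , a , _ = ≤-trans a (≤-reflexive (sym (eInto-in U (compl U) s (cong not us))))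

  blob-of-smaller : ∀ U X Y → X ⊆ᵇ compl U → Blob (U ∪ᵇ X) Y → e X Y ≡ 0 → Blob U Y
  blob-of-smaller U X Y X⊆ (Y⊆ , c≥1 , small , one-in , one-out) none =
    proj₁ outside , c≥1 , small , one-from-U , one-onward
    where
    open Move U X X⊆
    outside : (Y ⊆ᵇ compl U) × (∀ i → Y i ≡ true → X i ≡ false)
    outside = outside-∪ U X Y Y⊆
    one-from-U : e U Y ≡ 1
    one-from-U = begin
      e U Y          ≡⟨ +-identityʳ _ ⟨
      e U Y + 0      ≡⟨ cong (e U Y +_) none ⟨
      e U Y + e X Y  ≡⟨ e-∪ Y ⟨
      e (U ∪ᵇ X) Y   ≡⟨ one-in ⟩
      1 ∎
      where open ≡-Reasoning
    rest-in-X : (λ i → rest U Y i ∧ X i) ≐ X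
    rest-in-X i with X i in xi
    ... | false = ∧-zeroʳ _
    ... | true with Y i in yi
    ...   | true = false≢true (trans (sym (proj₂ outside i yi)) xi)
    ...   | false rewrite disjoint i xi = refl
    rest-off-X : (λ i → rest U Y i ∧ not (X i)) ≐ rest (U ∪ᵇ X) Y
    rest-off-X i with U i | X i | Y i
    ... | true | _ | _ = refl
    ... | false | true | true = refl
    ... | false | true | false = refl
    ... | false | false | true = refl
    ... | false | false | false = refl
    one-onward : e Y (rest U Y) ≡ 1
    one-onward = trans (e-splitʳ Y (rest U Y) X)
      (cong₂ _+_ (trans (e-congʳ Y rest-in-X) (trans (e-sym Y X) none)) (trans (e-congʳ Y rest-off-X) one-out))

  -- A set Z with ∂Z = 2, |Z| ≤ 4q and nonempty complement has at most half
  -- the vertices: otherwise its complement would have at most half of them,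
  -- hence at most 2q vertices by expansion, and |V| ≤ 6q.
  2-cut-half : ∀ Z → ∂ Z ≡ 2 → (∃ λ u → Z u ≡ false) → card Z ≤ 4 * q → 2 * card Z ≤ N
  2-cut-half Z ∂Z≡2 (u , u∉Z) Z≤4q with 2 * card Z ≤? N
  ... | yes half = half
  ... | no too-big = ⊥-elim (<⇒≱ large (begin
      N                         ≡⟨ card-compl Z ⟨
      card Z + card (compl Z)   ≤⟨ +-mono-≤ Z≤4q complement≤2q ⟩
      4 * q + 2 * q             ≡⟨ *-distribʳ-+ q 4 2 ⟨
      6 * q ∎))
    where
    open ≤-Reasoning
    ∂-compl : ∂ (compl Z) ≡ 2
    ∂-compl = trans (e-congʳ (compl Z) (λ i → not-involutive (Z i))) (trans (e-sym (compl Z) Z) ∂Z≡2)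
    complement≤2q : card (compl Z) ≤ 2 * q
    complement≤2q = ≤-trans (expansion (compl Z) (card-pos (compl Z) u (cong not u∉Z))
                              (complement-small (card Z) (card (compl Z)) N (≤-reflexive (card-compl Z)) (≰⇒> too-big)))
                            (≤-reflexive (trans (cong (q *_) ∂-compl) (*-comm q 2)))

  merge-blobs : ∀ U X Y → Nonempty U → Blob U X → Blob (U ∪ᵇ X) Y → e X Y ≡ 1 →
                Blob U (X ∪ᵇ Y) × (card (X ∪ᵇ Y) ≡ card X + card Y)
  merge-blobs U X Y (u , uu) bX@(X⊆ , cX≥1 , _ , X-in , X-out) bY@(Y⊆ , _ , _ , Y-in , Y-out) X-to-Y =
    (XY⊆ , cXY≥1 , half , XY-in , XY-out) , card-XY
    where
    XY : VSet
    XY = X ∪ᵇ Y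
    outside : (Y ⊆ᵇ compl U) × (∀ i → Y i ≡ true → X i ≡ false)
    outside = outside-∪ U X Y Y⊆
    Y⊆complX : Y ⊆ᵇ compl X
    Y⊆complX i yi rewrite proj₂ outside i yi = refl
    XY⊆ : XY ⊆ᵇ compl U
    XY⊆ i xyi with X i in xi
    ... | true = X⊆ i xi
    ... | false = proj₁ outside i xyi
    card-XY : card XY ≡ card X + card Y
    card-XY = Move.card-∪ X Y Y⊆complX
    cXY≥1 : 1 ≤ card XY
    cXY≥1 = ≤-trans cX≥1 (≤-trans (m≤m+n _ _) (≤-reflexive (sym card-XY)))
    U-to-Y : e U Y ≡ 0
    U-to-Y = +-cancelʳ-≡ 1 _ 0 (begin
      e U Y + 1      ≡⟨ cong (e U Y +_) X-to-Y ⟨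
      e U Y + e X Y  ≡⟨ Move.e-∪ U X X⊆ Y ⟨
      e (U ∪ᵇ X) Y   ≡⟨ Y-in ⟩
      1 ∎)
      where open ≡-Reasoning
    XY-in : e U XY ≡ 1
    XY-in = begin
      e U XY         ≡⟨ e-sym U XY ⟩
      e XY U         ≡⟨ Move.e-∪ X Y Y⊆complX U ⟩
      e X U + e Y U  ≡⟨ cong₂ _+_ (trans (e-sym X U) X-in) (trans (e-sym Y U) U-to-Y) ⟩
      1 ∎
      where open ≡-Reasoning
    rest-XY : rest U XY ≐ rest (U ∪ᵇ X) Y
    rest-XY i with U i | X i
    ... | true | _ = refl
    ... | false | true = refl
    ... | false | false = refl
    rest-in-Y : (λ i → rest U X i ∧ Y i) ≐ Y
    rest-in-Y i with Y i in yi
    ... | false = ∧-zeroʳ _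
    ... | true rewrite proj₂ outside i yi | Move.disjoint U Y (proj₁ outside) i yi = refl
    rest-off-Y : (λ i → rest U X i ∧ not (Y i)) ≐ rest U XY
    rest-off-Y i with U i | X i | Y i
    ... | true | _ | _ = refl
    ... | false | true | _ = refl
    ... | false | false | true = refl
    ... | false | false | false = refl
    X-onward : e X (rest U XY) ≡ 0
    X-onward = +-cancelˡ-≡ 1 _ 0 (begin
      1 + e X (rest U XY)
        ≡⟨ cong₂ _+_ (trans (sym X-to-Y) (e-congʳ X (λ i → sym (rest-in-Y i)))) (e-congʳ X (λ i → sym (rest-off-Y i))) ⟩
      e X (λ i → rest U X i ∧ Y i) + e X (λ i → rest U X i ∧ not (Y i))
        ≡⟨ e-splitʳ X (rest U X) Y ⟨
      e X (rest U X)
        ≡⟨ X-out ⟩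
      1 ∎)
      where open ≡-Reasoning
    XY-out : e XY (rest U XY) ≡ 1
    XY-out = trans (Move.e-∪ X Y Y⊆complX (rest U XY)) (cong₂ _+_ X-onward (trans (e-congʳ Y rest-XY) Y-out))
    ∂XY≡2 : ∂ XY ≡ 2
    ∂XY≡2 = trans (Move.∂X U XY XY⊆) (cong₂ _+_ XY-in XY-out)
    u∉XY : XY u ≡ false
    u∉XY with XY u in xyu
    ... | false = refl
    ... | true = false≢true (trans (sym (Move.disjoint U XY XY⊆ u xyu)) uu)
    half : 2 * card XY ≤ N
    half = 2-cut-half XY ∂XY≡2 (u , u∉XY) (begin
      card XY                 ≡⟨ card-XY ⟩
      card X + card Y         ≤⟨ +-mono-≤ (blob-size U X bX) (blob-size (U ∪ᵇ X) Y bY) ⟩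
      2 * q + 2 * q           ≡⟨ *-distribʳ-+ q 2 2 ⟨
      4 * q ∎)
      where open ≤-Reasoning

  ∨-false : ∀ a b → a ∨ b ≡ false → (a ≡ false) × (b ≡ false)
  ∨-false false false _ = refl , refl

  attached-before : ∀ U X → X ⊆ᵇ compl U → ∀ s → U s ≡ false → 1 ≤ nbrsIn (U ∪ᵇ X) s →
    (Y : Subset N) → Blob (U ∪ᵇ X) (lookup Y) → lookup Y s ≡ true → e X (lookup Y) ≡ 0 → attached U s ≡ true
  attached-before U X X⊆ s us a Y bY ys none =
    attached-intro U s us a-U (Y , blob-of-smaller U X (lookup Y) X⊆ bY none , ys)
    where
    no-X-nbr : nbrsIn X s ≡ 0
    no-X-nbr = n≤0⇒n≡0 (≤-trans (nbrsIn≤e X (lookup Y) s ys) (≤-reflexive none))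
    a-U : 1 ≤ nbrsIn U s
    a-U = ≤-trans a (≤-reflexive (trans (Move.nbrsIn-∪ U X X⊆ s) (trans (cong (nbrsIn U s +_) no-X-nbr) (+-identityʳ _))))

  attached-after-move : ∀ U X → X ⊆ᵇ compl U → ∀ s → attached (U ∪ᵇ X) s ≡ true →
                        (attached U s ≡ true) ⊎ (1 ≤ eInto X (rest U X) s)
  attached-after-move U X X⊆ s h with attached-elim (U ∪ᵇ X) s h
  ... | us' , a , (Y , bY , ys) with ∨-false (U s) (X s) us' | e X (lookup Y) ≟ 0
  ...   | us , _ | yes none = inj₁ (attached-before U X X⊆ s us a Y bY ys none)
  ...   | us , xs | no some = inj₂ (≤-trans a-X (≤-reflexive (sym (eInto-in X (rest U X) s (cong₂ (λ p r → not p ∧ not r) us xs)))))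
    where
    U-to-Y : e U (lookup Y) ≡ 0
    U-to-Y = n≤0⇒n≡0 (+-cancelʳ-≤ 1 _ 0 (≤-trans (+-monoʳ-≤ (e U (lookup Y)) (n≢0⇒n>0 some))
               (≤-reflexive (trans (sym (Move.e-∪ U X X⊆ (lookup Y))) (proj₁ (proj₂ (proj₂ (proj₂ bY))))))))
    no-U-nbr : nbrsIn U s ≡ 0
    no-U-nbr = n≤0⇒n≡0 (≤-trans (nbrsIn≤e U (lookup Y) s ys) (≤-reflexive U-to-Y))
    a-X : 1 ≤ nbrsIn X s
    a-X = ≤-trans a (≤-reflexive (trans (Move.nbrsIn-∪ U X X⊆ s) (cong (_+ nbrsIn X s) no-U-nbr)))

  -- After absorbing a largest blob X, no vertex becomes newly attached: a
  -- blob of U ∪ X reached from X would merge with X into a larger blob.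
  attached-after-blob : ∀ U X → Nonempty U → Blob U X → (∀ Y → Blob U Y → card Y ≤ card X) →
                        ∀ s → attached (U ∪ᵇ X) s ≡ true → attached U s ≡ true
  attached-after-blob U X U≢∅ bX largest s h with attached-elim (U ∪ᵇ X) s h
  ... | us' , a , (Y , bY , ys) with ∨-false (U s) (X s) us' | e X (lookup Y) ≟ 0
  ...   | us , _ | yes none = attached-before U X (proj₁ bX) s us a Y bY ys none
  ...   | _ | no some = ⊥-elim (<⇒≱ bigger (largest (X ∪ᵇ lookup Y) (proj₁ merged)))
    where
    Y⊆rest : lookup Y ⊆ᵇ rest U X
    Y⊆rest i yi = trans (sym (Move.compl-∪ U X (proj₁ bX) i)) (proj₁ bY i yi)
    X-to-Y : e X (lookup Y) ≡ 1
    X-to-Y = ≤-antisym (≤-trans (e-monoʳ X Y⊆rest) (≤-reflexive (proj₂ (proj₂ (proj₂ (proj₂ bX))))))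
                       (n≢0⇒n>0 some)
    merged : Blob U (X ∪ᵇ lookup Y) × (card (X ∪ᵇ lookup Y) ≡ card X + card (lookup Y))
    merged = merge-blobs U X (lookup Y) U≢∅ bX bY X-to-Y
    bigger : card X < card (X ∪ᵇ lookup Y)
    bigger = ≤-trans (≤-trans (≤-reflexive (+-comm 1 (card X))) (+-monoʳ-≤ (card X) (proj₁ (proj₂ bY))))
                     (≤-reflexive (sym (proj₂ merged)))

  #attached-after-move : ∀ U X → X ⊆ᵇ compl U → #attached (U ∪ᵇ X) ≤ #attached U + e X (rest U X)
  #attached-after-move U X X⊆ = ≤-trans (sum-mono pointwise)
    (≤-reflexive (trans (sum-+ (λ s → ⟦ attached U s ⟧) (eInto X (rest U X))) (cong (#attached U +_) (sym (e-eInto X (rest U X))))))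
    where
    pointwise : ∀ s → ⟦ attached (U ∪ᵇ X) s ⟧ ≤ ⟦ attached U s ⟧ + eInto X (rest U X) s
    pointwise s with attached (U ∪ᵇ X) s in at
    ... | false = z≤n
    ... | true with attached-after-move U X X⊆ s at
    ...   | inj₁ before rewrite before = s≤s z≤n
    ...   | inj₂ new = ≤-trans new (m≤n+m _ _)

  -- Absorbing a largest blob X strictly lowers #attached: the end in X of
  -- the unique U–X edge stops being attached.
  #attached-after-blob : ∀ U X → Nonempty U → Blob U X → (∀ Y → Blob U Y → card Y ≤ card X) →
                         #attached (U ∪ᵇ X) < #attached U
  #attached-after-blob U X U≢∅ bX largest
    with sum-pos (eInto U X) (≤-trans (s≤s z≤n) (≤-reflexive (trans (sym (proj₁ (proj₂ (proj₂ (proj₂ bX))))) (e-eInto U X))))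
  ... | s , into-s with X s Bool.≟ true
  ...   | no xs = ⊥-elim (<⇒≱ into-s (≤-reflexive (eInto-out U X s (¬-not xs))))
  ...   | yes xs = sum-strict (λ t → ⟦⟧-mono (attached-after-blob U X U≢∅ bX largest t)) s detached
    where
    was : attached U s ≡ true
    was = attached-intro U s (Move.disjoint U X (proj₁ bX) s xs)
            (≤-trans into-s (≤-reflexive (eInto-in U X s xs))) (inBlob-intro s bX xs)
    now : attached (U ∪ᵇ X) s ≡ false
    now rewrite xs with U s
    ... | true = refl
    ... | false = refl
    detached : ⟦ attached (U ∪ᵇ X) s ⟧ < ⟦ attached U s ⟧
    detached rewrite was | now = s≤s z≤n

blob-weight : ℕ → ℕ
blob-weight q = suc (2 * q)

boundary-weight : ℕ → ℕ
boundary-weight q = suc (3 * (q + blob-weight q))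

-- Starting from a
-- nonempty U we repeatedly absorb a small side of a weak split of V ∖ U;
-- each step lowers  Φ U = A·∂U + |U| + B·#attached U,  so the process stops,
-- with V ∖ U empty or 2-connected, and the final |U| ≤ Φ of the start.
module Descent (G : Graph) (deg≤3 : ∀ u → degree G u ≤ 3)
    (∂≥2 : ∀ (Y : Counting.VSet G) → (∃ λ i → Y i ≡ true) → (∃ λ j → Y j ≡ false) → 2 ≤ Counting.∂ G Y)
    (q : ℕ) (q≥1 : 1 ≤ q)
    (expansion : ∀ (X : Counting.VSet G) → 1 ≤ Counting.card G X → 2 * Counting.card G X ≤ n G →
                 Counting.card G X ≤ q * Counting.∂ G X)
    (large : 6 * q < n G) where
  open Counting G
  open Moves G
  open WeakSplits G deg≤3
  open Blobs G q expansion large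
  open PotentialArithmetic

  B : ℕ
  B = blob-weight q

  A : ℕ
  A = boundary-weight q

  Φ : VSet → ℕ
  Φ U = A * ∂ U + card U + B * #attached U

  card≤Φ : ∀ U → card U ≤ Φ U
  card≤Φ U = ≤-trans (m≤n+m (card U) (A * ∂ U)) (m≤m+n _ _)

  cheap-move : ∀ U X → X ⊆ᵇ compl U → 1 ≤ card X → 2 * card X ≤ N → e X (rest U X) ≤ 1 →
               e X (rest U X) < e U X → Φ (U ∪ᵇ X) < Φ U
  cheap-move U X X⊆ c≥1 small onward≤1 onward<back =
    subst (λ z → A * ∂ (U ∪ᵇ X) + z + B * #attached (U ∪ᵇ X) < Φ U) (sym (Move.card-∪ U X X⊆))
      (decrease-when-∂-drops q B (∂ U) (∂ (U ∪ᵇ X)) (e U X) (e X (rest U X)) (card U) (card X)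
        (#attached U) (#attached (U ∪ᵇ X)) (Move.∂-after U X X⊆) onward<back onward≤1 X-size
        (#attached-after-move U X X⊆))
    where
    X-size : card X ≤ q * (e U X + e X (rest U X))
    X-size = ≤-trans (expansion X c≥1 small) (≤-reflexive (cong (q *_) (Move.∂X U X X⊆)))

  blob-move : ∀ U X → Nonempty U → Blob U X → (∀ Y → Blob U Y → card Y ≤ card X) → Φ (U ∪ᵇ X) < Φ U
  blob-move U X U≢∅ bX largest =
    subst (λ z → A * ∂ (U ∪ᵇ X) + z + B * #attached (U ∪ᵇ X) < Φ U) (sym (Move.card-∪ U X X⊆))
      (subst (λ z → A * z + (card U + card X) + B * #attached (U ∪ᵇ X) < Φ U) (sym ∂-same)
        (decrease-when-attached-drops A B (∂ U) (card U) (card X) (#attached U) (#attached (U ∪ᵇ X))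
          (s≤s (blob-size U X bX)) (#attached-after-blob U X U≢∅ bX largest)))
    where
    X⊆ : X ⊆ᵇ compl U
    X⊆ = proj₁ bX
    ∂-same : ∂ (U ∪ᵇ X) ≡ ∂ U
    ∂-same = +-cancelʳ-≡ 1 _ _ (begin
      ∂ (U ∪ᵇ X) + 1          ≡⟨ cong (∂ (U ∪ᵇ X) +_) (proj₁ (proj₂ (proj₂ (proj₂ bX)))) ⟨
      ∂ (U ∪ᵇ X) + e U X      ≡⟨ Move.∂-after U X X⊆ ⟩
      ∂ U + e X (rest U X)    ≡⟨ cong (∂ U +_) (proj₂ (proj₂ (proj₂ (proj₂ bX)))) ⟩
      ∂ U + 1 ∎)
      where open ≡-Reasoning

  SmallSide : VSet → Set
  SmallSide U = Σ VSet λ X → (X ⊆ᵇ compl U) × (1 ≤ card X) × (2 * card X ≤ N) ×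
                              (e X (rest U X) ≤ 1) × (∃ λ j → X j ≡ false)

  small-side : ∀ U → WeakSplit (compl U) → SmallSide U
  small-side U (X , X⊆ , (i , xi) , (j , yj) , few) with 2 * card X ≤? N
  ... | yes small = X , X⊆ , card-pos X i xi , small , few , (j , proj₂ (∧-not (not (U j)) (X j) yj))
  ... | no big = Y , Y⊆ , card-pos Y j yj , Y-small , Y-few , (i , yi)
    where
    Y : VSet
    Y = rest U X
    Y⊆ : Y ⊆ᵇ compl U
    Y⊆ k yk = proj₁ (∧-not (not (U k)) (X k) yk)
    yi : Y i ≡ false
    yi rewrite xi = ∧-zeroʳ _
    rest-of-Y : rest U Y ≐ X
    rest-of-Y k with U k in uk | X k in xk
    ... | true | true = false≢true (trans (sym (cong not uk)) (X⊆ k xk))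
    ... | true | false = refl
    ... | false | true = refl
    ... | false | false = refl
    Y-few : e Y (rest U Y) ≤ 1
    Y-few = ≤-trans (≤-reflexive (trans (e-congʳ Y rest-of-Y) (e-sym Y X))) few
    X-in-compl : (λ k → compl U k ∧ X k) ≐ X
    X-in-compl k with X k in xk
    ... | true rewrite X⊆ k xk = refl
    ... | false = ∧-zeroʳ _
    X+Y≤N : card X + card Y ≤ N
    X+Y≤N = ≤-trans (≤-reflexive (sym (trans (card-split (compl U) X) (cong (_+ card Y) (card-cong X-in-compl)))))
                    (card-bound (compl U))
    Y-small : 2 * card Y ≤ N
    Y-small = complement-small (card X) (card Y) N X+Y≤N (≰⇒> big)

  largest-blob : ∀ U X → Blob U X → Σ VSet λ X* → Blob U X* × (∀ Y → Blob U Y → card Y ≤ card X*)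
  largest-blob U X bX = search N X bX (m≤n+m N (card X))
    where
    search : ∀ fuel X → Blob U X → N ≤ card X + fuel →
             Σ VSet λ X* → Blob U X* × (∀ Y → Blob U Y → card Y ≤ card X*)
    search zero X bX N≤ = X , bX , (λ Y _ → ≤-trans (card-bound Y) (≤-trans N≤ (≤-reflexive (+-identityʳ _))))
    search (suc fuel) X bX N≤ with anySubset? (λ Y → blob? U (lookup Y) ×-dec (suc (card X) ≤? card (lookup Y)))
    ... | yes (Y , bY , bigger) =
      search fuel (lookup Y) bY (≤-trans N≤ (≤-trans (≤-reflexive (+-suc (card X) fuel)) (+-monoˡ-≤ fuel bigger)))
    ... | no none = X , bX , λ Y bY → ≮⇒≥ (λ bigger →
      none (tabulate Y , Blob-cong (λ i → sym (lookup∘tabulate Y i)) bY ,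
            ≤-trans bigger (≤-reflexive (card-cong (λ i → sym (lookup∘tabulate Y i))))))

  Good : VSet → Set
  Good U = Empty (∁ (tabulate U)) ⊎ TwoConnectedOn G (∁ (tabulate U))

  Progress : VSet → Set
  Progress U = Σ VSet λ X → (X ⊆ᵇ compl U) × Φ (U ∪ᵇ X) < Φ U

  -- If only one or two vertices are left, absorb them all: they send no
  -- edge onward and receive ≥ 2 edges from U.
  absorb-all : ∀ U → Nonempty U → 1 ≤ card (compl U) → card (compl U) ≤ 2 → Progress U
  absorb-all U U≢∅ c≥1 c≤2 =
    compl U , (λ _ h → h) , cheap-move U (compl U) (λ _ h → h) c≥1 small (≤-trans (≤-reflexive none-onward) z≤n) back
    where
    nothing-left : rest U (compl U) ≐ (λ _ → false)
    nothing-left i with U i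
    ... | true = refl
    ... | false = refl
    none-onward : e (compl U) (rest U (compl U)) ≡ 0
    none-onward = trans (e-congʳ (compl U) nothing-left) (sum-zero _ (λ u → sum-zero _ (λ v →
                    cong ⟦_⟧ (trans (cong (compl U u ∧_) (∧-zeroʳ (adj G u v))) (∧-zeroʳ _)))))
    small : 2 * card (compl U) ≤ N
    small = ≤-trans (*-monoʳ-≤ 2 c≤2) (≤-trans (≤-trans (s≤s (s≤s (s≤s (s≤s z≤n)))) (*-monoʳ-≤ 6 q≥1)) (<⇒≤ large))
    back : e (compl U) (rest U (compl U)) < e U (compl U)
    back rewrite none-onward with card-pos⁻ (compl U) c≥1
    ... | j , uj = ≤-trans (s≤s z≤n) (∂≥2 U U≢∅ (j , trans (sym (not-involutive (U j))) (cong not uj)))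

  -- Given a small side X: if X sends fewer edges onward than back to U,
  -- absorb X; X cannot be cut off from U (its boundary would be < 2); and
  -- otherwise X is a blob, and we absorb a largest blob.
  absorb-small-side : ∀ U → Nonempty U → SmallSide U → Progress U
  absorb-small-side U U≢∅ (X , X⊆ , c≥1 , small , onward≤1 , (j , xj)) with e X (rest U X) <? e U X
  ... | yes onward<back = X , X⊆ , cheap-move U X X⊆ c≥1 small onward≤1 onward<back
  ... | no back≤onward with e U X ≟ 0
  ...   | yes isolated = ⊥-elim (<⇒≱ ∂X<2 (∂≥2 X (card-pos⁻ X c≥1) (j , xj)))
    where
    ∂X<2 : ∂ X < 2
    ∂X<2 = begin-strict
      ∂ X                     ≡⟨ Move.∂X U X X⊆ ⟩
      e U X + e X (rest U X)  ≡⟨ cong (_+ e X (rest U X)) isolated ⟩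
      e X (rest U X)          <⟨ s≤s onward≤1 ⟩
      2 ∎
      where open ≤-Reasoning
  ...   | no touching with largest-blob U X (X⊆ , c≥1 , small , back≡1 , onward≡1)
    where
    back≡1 : e U X ≡ 1
    back≡1 = ≤-antisym (≤-trans (≮⇒≥ back≤onward) onward≤1) (n≢0⇒n>0 touching)
    onward≡1 : e X (rest U X) ≡ 1
    onward≡1 = ≤-antisym onward≤1 (≤-trans (n≢0⇒n>0 touching) (≮⇒≥ back≤onward))
  ...     | X* , blob , largest = X* , proj₁ blob , blob-move U X* U≢∅ blob largest

  improve : ∀ U → Nonempty U → Good U ⊎ Progress U
  improve U U≢∅ with outcome U
  ... | complement-empty empty = inj₁ (inj₁ empty)
  ... | complement-2-connected tc = inj₁ (inj₂ tc)
  ... | complement-tiny c≥1 c≤2 = inj₂ (absorb-all U U≢∅ c≥1 c≤2)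
  ... | complement-weak-split weak = inj₂ (absorb-small-side U U≢∅ (small-side U weak))

  descend : ∀ W → Nonempty W → ∀ fuel U → W ⊆ᵇ U → Φ U ≤ fuel →
            Σ VSet λ Ŵ → (W ⊆ᵇ Ŵ) × (card Ŵ ≤ Φ U) × Good Ŵ
  descend W (w , ww) fuel U W⊆U Φ≤ with improve U (w , W⊆U w ww)
  ... | inj₁ good = U , W⊆U , card≤Φ U , good
  descend W W≢∅ zero U W⊆U Φ≤ | inj₂ (X , _ , smaller) = ⊥-elim (<⇒≱ smaller (≤-trans Φ≤ z≤n))
  descend W W≢∅ (suc fuel) U W⊆U Φ≤ | inj₂ (X , _ , smaller)
    with descend W W≢∅ fuel (U ∪ᵇ X) W⊆U∪X (≤-pred (≤-trans smaller Φ≤))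
    where
    W⊆U∪X : W ⊆ᵇ (U ∪ᵇ X)
    W⊆U∪X i wi rewrite W⊆U i wi = refl
  ... | Ŵ , W⊆Ŵ , size , good = Ŵ , W⊆Ŵ , ≤-trans size (<⇒≤ smaller) , good

-- A rational expansion bound gives an integral one: if ε = (1+p)/(1+d) > 0
-- and ε·x ≤ y, then (1+p)·x ≤ (1+d)·y, so x ≤ (1+d)·y.
expansion-bound : ∀ (ε : ℚ.ℚ) → ℚ.0ℚ ℚ.< ε → ∀ x y →
  ε ℚ.* (ℤ.+ x ℚ./ 1) ℚ.≤ (ℤ.+ y ℚ./ 1) → x ≤ suc (ℚ.ℚ.denominator-1 ε) * y
expansion-bound (ℚ.mkℚ (ℤ.+ zero) _ _) (ℚ.*<* (ℤ.+<+ ())) x y _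
expansion-bound (ℚ.mkℚ ℤ.-[1+ _ ] _ _) (ℚ.*<* ()) x y _
expansion-bound ε@(ℚ.mkℚ ℤ.+[1+ p ] d _) _ x y εx≤y with as-unnormalised
  where
  as-unnormalised : ℚ.toℚᵘ ε U.* U.mkℚᵘ (ℤ.+ x) 0 U.≤ U.mkℚᵘ (ℤ.+ y) 0
  as-unnormalised =
    UP.≤-respʳ-≃ (ℚP.toℚᵘ-fromℚᵘ (U.mkℚᵘ (ℤ.+ y) 0))
      (UP.≤-respˡ-≃ (UP.≃-trans (ℚP.toℚᵘ-homo-* ε (ℤ.+ x ℚ./ 1)) (UP.*-congˡ {ℚ.toℚᵘ ε} (ℚP.toℚᵘ-fromℚᵘ (U.mkℚᵘ (ℤ.+ x) 0))))
        (ℚP.toℚᵘ-mono-≤ εx≤y))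
... | U.*≤* cross-multiplied = begin
    x                         ≤⟨ m≤m+n x (p * x) ⟩
    suc p * x                 ≡⟨ *-identityʳ (suc p * x) ⟨
    suc p * x * 1             ≤⟨ ZP.drop‿+≤+ in-ℕ ⟩
    y * suc (d * 1)           ≡⟨ cong (λ z → y * suc z) (*-identityʳ d) ⟩
    y * suc d                 ≡⟨ *-comm y (suc d) ⟩
    suc d * y ∎
  where
  open ≤-Reasoning
  in-ℕ : ℤ.+ (suc p * x * 1) ℤ.≤ ℤ.+ (y * suc (d * 1))
  in-ℕ = subst₂ ℤ._≤_ (trans (cong (ℤ._* ℤ.+ 1) (ZP.+◃n≡+n (suc p * x))) (sym (ZP.pos-* (suc p * x) 1)))
                      (sym (ZP.pos-* y (suc (d * 1)))) cross-multiplied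

-- Φ W ≤ potential-factor q · |W| for the starting set W of the descent.
potential-factor : ℕ → ℕ
potential-factor q = suc (3 * boundary-weight q + 3 * blob-weight q)

constant : ℕ → ℕ
constant q = 6 * q + potential-factor q

constant-pos : ∀ q → 0 < constant q
constant-pos q = ≤-trans (s≤s z≤n) (m≤n+m (potential-factor q) (6 * q))

∁⊥≡⊤ : ∀ {m} → ∁ (Sub.⊥ {m}) ≡ ⊤
∁⊥≡⊤ = trans (sym (∪-identityˡ (∁ Sub.⊥))) (p∪∁p≡⊤ Sub.⊥)

module OneGraph (G : Graph) (cubic : Cubic G) (tc : TwoConnected G) (q : ℕ) (q≥1 : 1 ≤ q)
    (expansion : ∀ (X : Counting.VSet G) → 1 ≤ Counting.card G X → 2 * Counting.card G X ≤ n G →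
                 Counting.card G X ≤ q * Counting.∂ G X) where
  open Counting G

  deg≤3 : ∀ u → degree G u ≤ 3
  deg≤3 u = ≤-reflexive (cubic u)

  deg≥2 : ∀ u → 2 ≤ degree G u
  deg≥2 u = ≤-trans (s≤s (s≤s z≤n)) (≤-reflexive (sym (cubic u)))

  Result : Subset N → Set
  Result W = Σ (Subset N) (λ Ŵ → (W ⊆ Ŵ) × (∣ Ŵ ∣ ≤ constant q * ∣ W ∣) × (Empty (∁ Ŵ) ⊎ TwoConnectedOn G (∁ Ŵ)))

  empty-W : ∀ W → Empty W → Result W
  empty-W W empty = W , (λ x → x) , ≤-trans (≤-reflexive (sym (*-identityˡ ∣ W ∣))) (*-monoˡ-≤ ∣ W ∣ (constant-pos q)) ,
                    inj₂ (subst (TwoConnectedOn G) (sym ∁W≡⊤) tc)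
    where
    ∁W≡⊤ : ∁ W ≡ ⊤
    ∁W≡⊤ = trans (cong ∁ (Empty-unique empty)) ∁⊥≡⊤

  small-G : ∀ W → Sub.Nonempty W → N ≤ 6 * q → Result W
  small-G W (w , w∈W) N≤6q = ⊤ , (λ _ → ∈⊤) , size , inj₁ (λ (x , x∈∁⊤) → x∈∁p⇒x∉p x∈∁⊤ ∈⊤)
    where
    size : ∣ ⊤ {N} ∣ ≤ constant q * ∣ W ∣
    size = begin
      ∣ ⊤ {N} ∣             ≡⟨ ∣⊤∣≡n N ⟩
      N                     ≤⟨ N≤6q ⟩
      6 * q                 ≤⟨ m≤m+n (6 * q) _ ⟩
      constant q            ≡⟨ *-identityʳ (constant q) ⟨
      constant q * 1        ≤⟨ *-monoʳ-≤ (constant q) (≤-trans (card-pos (lookup W) w (mem→ w∈W)) (≤-reflexive (sym (card-vec W)))) ⟩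
      constant q * ∣ W ∣ ∎
      where open ≤-Reasoning

  large-G : ∀ W → Sub.Nonempty W → 6 * q < N → Result W
  large-G W (w , w∈W) large = tabulate Ŵ , W⊆Ŵ , size , good
    where
    open Descent G deg≤3 (EdgeCuts.∂≥2 G tc deg≥2) q q≥1 expansion large
    descent : Σ VSet λ Ŵ → (lookup W ⊆ᵇ Ŵ) × (card Ŵ ≤ Φ (lookup W)) × Good Ŵ
    descent = descend (lookup W) (w , mem→ w∈W) (Φ (lookup W)) (lookup W) (λ _ h → h) ≤-refl
    Ŵ : VSet
    Ŵ = proj₁ descent
    W⊆Ŵ : W ⊆ tabulate Ŵ
    W⊆Ŵ {x} x∈W = →mem (trans (lookup∘tabulate Ŵ x) (proj₁ (proj₂ descent) x (mem→ x∈W)))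
    size : ∣ tabulate Ŵ ∣ ≤ constant q * ∣ W ∣
    size = begin
      ∣ tabulate Ŵ ∣      ≡⟨ card-tab Ŵ ⟩
      card Ŵ              ≤⟨ proj₁ (proj₂ (proj₂ descent)) ⟩
      Φ (lookup W)        ≤⟨ PotentialArithmetic.initial-bound (boundary-weight q) (blob-weight q) (∂ (lookup W))
                                (card (lookup W)) (#attached (lookup W)) (∂≤degree*card 3 deg≤3 (lookup W))
                                (#attached≤∂ (lookup W)) ⟩
      potential-factor q * card (lookup W) ≡⟨ cong (potential-factor q *_) (card-vec W) ⟨
      potential-factor q * ∣ W ∣           ≤⟨ *-monoˡ-≤ ∣ W ∣ (m≤n+m (potential-factor q) (6 * q)) ⟩
      constant q * ∣ W ∣ ∎
      where
      open ≤-Reasoning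
      open Blobs G q expansion large using (#attached; #attached≤∂)
    good : Empty (∁ (tabulate Ŵ)) ⊎ TwoConnectedOn G (∁ (tabulate Ŵ))
    good = proj₂ (proj₂ (proj₂ descent))

  theorem : ∀ W → Result W
  theorem W with nonempty? W | N ≤? 6 * q
  ... | no empty | _ = empty-W W empty
  ... | yes nonempty | yes small = small-G W nonempty small
  ... | yes nonempty | no big = large-G W nonempty (≰⇒> big)

integral-expansion : ∀ (ε : ℚ.ℚ) → ℚ.0ℚ ℚ.< ε → ∀ G → ExpansionAtLeast ε G →
  let open Counting G in
  ∀ (X : VSet) → 1 ≤ card X → 2 * card X ≤ n G → card X ≤ suc (ℚ.ℚ.denominator-1 ε) * ∂ X
integral-expansion ε ε>0 G expands X c≥1 small =
  subst₂ (λ a b → a ≤ suc (ℚ.ℚ.denominator-1 ε) * b) (card-tab X) (boundarySize≡∂ X)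
    (expansion-bound ε ε>0 ∣ tabulate X ∣ (boundarySize G (tabulate X))
      (expands (tabulate X) (subst (1 ≤_) (sym (card-tab X)) c≥1) (subst (λ z → 2 * z ≤ n G) (sym (card-tab X)) small)))
  where open Counting G

mainTheorem8 : (ℰ : Family) → IsExpanderFamily ℰ → (∀ G → ℰ G → Cubic G × TwoConnected G) →
    Σ ℕ (λ c → (0 < c) × (∀ (G : Graph) → ℰ G → ∀ (W : Subset (n G)) →
    Σ (Subset (n G)) (λ Ŵ → (W ⊆ Ŵ) × (∣ Ŵ ∣ ≤ c * ∣ W ∣) × (Empty (∁ Ŵ) ⊎ TwoConnectedOn G (∁ Ŵ)))))
mainTheorem8 ℰ (_ , ε , ε>0 , expands) cubic-2-connected =
  constant q , constant-pos q , λ G G∈ℰ →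
    OneGraph.theorem G (proj₁ (cubic-2-connected G G∈ℰ)) (proj₂ (cubic-2-connected G G∈ℰ)) q (s≤s z≤n)
      (integral-expansion ε ε>0 G (expands G G∈ℰ))
  where
  q : ℕ
  q = suc (ℚ.ℚ.denominator-1 ε)
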